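{- Let $r\ge2$, $\mathbf{k}=(k_1,\dots,k_r)\in\mathbb{Z}_{\ge1}^r$ and $t\in\mathbb{Z}_{\ge0}$. Then \[ f(\mathbf{k},t)=-\sum_{u=0}^{t}g(\mathbf{k}_u,t-u),\qquad g(\mathbf{k},t)=-\sum_{u=0}^{t}(-1)^u f(\mathbf{k}_u,t-u). \]
   Context: For $k_1\ge2$, $\zeta(k_1,\dots,k_r)=\sum_{n_1>\cdots>n_r\ge1}n_1^{ -k_1}\cdots n_r^{ -k_r}$, and for $(k_1,\dots,k_r)\in\mathbb{Z}_{\ge1}^r$, $\zeta^+(k_1,\dots,k_r):=\zeta(k_1+1,k_2,\dots,k_r)$. For a tuple $\mathbf{k}$, $|\mathbf{k}|$ is the sum of its entries and its depth its length; $\mathbf{k}+\mathbf{e}$ is componentwise addition of tuples of equal depth; $\mathbf{e}\ge0$ means all components are non-negative integers; $\{1\}^m$ is $m$ entries equal to $1$. Hoffman's dual: for $\mathbf{k}=(k_1,\dots,k_r)$ of weight $n$ let $S(\mathbf{k})=\{k_1,k_1+k_2,\dots,k_1+\cdots+k_{r-1}\}$; $\mathbf{k}^\vee$ is the unique index of weight $n$ with $S(\mathbf{k}^\vee)=\{1,\dots,n-1\}\setminus S(\mathbf{k})$. The naive shuffle $(a_1,\dots,a_p)\,\text{ш}\,(b_1,\dots,b_q)$ is the formal sum (with multiplicity) of all sequences obtained by interleaving the two sequences preserving the internal orders (e.g. $(3,1)\,\text{ш}\,(2)=(2,3,1)+(3,2,1)+(3,1,2)$). For $\mathbf{k}=(k_1,\dots,k_r)$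 with $r\ge2$ and $u\ge0$, $\mathbf{k}_u$ denotes the formal sum of indices $(k_1,((k_2,\dots,k_{r-1})\,\text{ш}\,\{1\}^u),k_r)$. For an index $\mathbf{k}$ of depth $r\ge2$ and $t\ge0$ define $f_L(\mathbf{k},t)=\sum_{m_1+\cdots+m_r=r+t,\ m_i\ge1}\ \sum_{\mathbf{a}_i\in\mathbb{Z}_{\ge1}^{m_i},\ |\mathbf{a}_i|=k_i+m_i-1}\zeta^+(\mathbf{a}_1,\dots,\mathbf{a}_r)$ (concatenation), $f_R(\mathbf{k},t)=\sum_{l=0}^t\sum_{m_1+\cdots+m_{r-1}=t-l,\ m_i\ge0}\sum_{|\mathbf{e}|=l,\ \mathbf{e}\ge0}\zeta^+((k_1,\{1\}^{m_1},\dots,k_{r-1},\{1\}^{m_{r-1}},k_r)+\mathbf{e})$, $g_L(\mathbf{k},t)=\sum_{|\mathbf{e}|=t,\ \mathbf{e}\ge0}\zeta^+(\mathbf{k}+\mathbf{e})$, $g_R(\mathbf{k},t)=\sum_{|\mathbf{e}'|=t,\ \mathbf{e}'\ge0}\zeta^+((\mathbf{k}^\vee+\mathbf{e}')^\vee)$ (with $\mathbf{e}'$ of the depth of $\mathbf{k}^\vee$; $g_L,g_R$ are defined for indices of any depth), $f=f_L-f_R$, $g=g_L-g_R$, all extended $\mathbb{Q}$-linearly in the index argument to formal sums of indices. -}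

module Defs where

open import Data.Nat as ℕ using (ℕ; zero; suc)
open import Data.Bool using (Bool; true; false; not)
open import Data.List using (List; []; _∷_; _++_; [_]; map; concatMap; upTo; replicate; zipWith; zip; length; foldr)
open import Data.Product using (_×_; _,_; ∃)
open import Data.Integer using (+_)
open import Data.Rational using (ℚ; 0ℚ; 1ℚ; _+_; _*_; -_; _/_; ∣_∣; _≤_; _<_)

-- An index is a finite list of natural numbers (entries ≥ 1 are imposed
-- as hypotheses where needed).  A formal ℚ-linear combination of indices
-- with all coefficients 1 (a "formal sum with multiplicity") is a List Index.
Index : Set
Index = List ℕ

pow : ℚ → ℕ → ℚ
pow q zero    = 1ℚ
pow q (suc k) = q * pow q k

-- ζ_N(k₁,…,k_r) = Σ_{N ≥ n₁ > n₂ > ⋯ > n_r ≥ 1} n₁^{-k₁} ⋯ n_r^{-k_r}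
zetaN : ℕ → Index → ℚ
zetaN N []       = 1ℚ
zetaN zero (k ∷ ks) = 0ℚ
zetaN (suc N) (k ∷ ks) = pow (+ 1 / suc N) k * zetaN N ks + zetaN N (k ∷ ks)

zetaPlusN : ℕ → Index → ℚ
zetaPlusN N []       = 1ℚ   -- never used (all indices occurring are non-empty)
zetaPlusN N (k ∷ ks) = zetaN N (suc k ∷ ks)

sumℚ : List ℚ → ℚ
sumℚ = foldr _+_ 0ℚ

comps : ℕ → ℕ → List Index
comps zero zero    = [ [] ]
comps zero (suc s) = []
comps (suc m) s = concatMap (λ a → map (suc a ∷_) (comps m (s ℕ.∸ suc a))) (upTo s)

wcomps : ℕ → ℕ → List Index
wcomps zero zero    = [ [] ]
wcomps zero (suc s) = []
wcomps (suc m) s = concatMap (λ a → map (a ∷_) (wcomps m (s ℕ.∸ a))) (upTo (suc s))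

addE : Index → Index → Index
addE = zipWith ℕ._+_

sh : Index → Index → List Index
sh [] ys = [ ys ]
sh (x ∷ xs) [] = [ x ∷ xs ]
sh (x ∷ xs) (y ∷ ys) = map (x ∷_) (sh xs (y ∷ ys)) ++ map (y ∷_) (sh (x ∷ xs) ys)

kU : ℕ → Index → ℕ → ℕ → List Index
kU k₁ middle kr u = map (λ w → k₁ ∷ (w ++ [ kr ])) (sh middle (replicate u 1))

-- For k of weight n, toBits k is the characteristic vector (b₁,…,b_{n-1})
-- of S(k) = {k₁, k₁+k₂, …, k₁+⋯+k_{r-1}} ⊆ {1,…,n-1}  (b_j = true iff j ∈ S(k)),
-- and fromBits is its inverse (recovering the index from its partial-sum set).
toBits : Index → List Bool
toBits []           = []
toBits (k ∷ [])     = replicate (k ℕ.∸ 1) false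
toBits (k ∷ k' ∷ ks) = replicate (k ℕ.∸ 1) false ++ (true ∷ toBits (k' ∷ ks))

fromBitsFrom : ℕ → List Bool → Index
fromBitsFrom c []           = [ c ]
fromBitsFrom c (true ∷ bs)  = c ∷ fromBitsFrom 1 bs
fromBitsFrom c (false ∷ bs) = fromBitsFrom (suc c) bs

fromBits : List Bool → Index
fromBits = fromBitsFrom 1

-- S(k^∨) = {1,…,n-1} ∖ S(k)
dual : Index → Index
dual k = fromBits (map not (toBits k))

blocks : List (ℕ × ℕ) → List Index
blocks [] = [ [] ]
blocks ((k , m) ∷ rest) =
  concatMap (λ a → map (a ++_) (blocks rest)) (comps m (k ℕ.+ m ℕ.∸ 1))

fLN : ℕ → Index → ℕ → ℚ
fLN N k t = sumℚ (map (λ ms → sumℚ (map (zetaPlusN N) (blocks (zip k ms))))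
                      (comps (length k) (length k ℕ.+ t)))

insOnes : Index → Index → Index
insOnes ks [] = ks
insOnes [] (m ∷ ms) = []
insOnes (k ∷ ks) (m ∷ ms) = k ∷ (replicate m 1 ++ insOnes ks ms)

fRN : ℕ → Index → ℕ → ℚ
fRN N k t = sumℚ (map (λ l →
              sumℚ (map (λ ms →
                let idx = insOnes k ms in
                sumℚ (map (λ e → zetaPlusN N (addE idx e)) (wcomps (length idx) l)))
              (wcomps (length k ℕ.∸ 1) (t ℕ.∸ l))))
            (upTo (suc t)))

gLN : ℕ → Index → ℕ → ℚ
gLN N k t = sumℚ (map (λ e → zetaPlusN N (addE k e)) (wcomps (length k) t))

gRN : ℕ → Index → ℕ → ℚ
gRN N k t = sumℚ (map (λ e → zetaPlusN N (dual (addE (dual k) e)))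
                      (wcomps (length (dual k)) t))

fN : ℕ → Index → ℕ → ℚ
fN N k t = fLN N k t + (- fRN N k t)

gN : ℕ → Index → ℕ → ℚ
gN N k t = gLN N k t + (- gRN N k t)

fΣ : ℕ → List Index → ℕ → ℚ
fΣ N ks t = sumℚ (map (λ k → fN N k t) ks)

gΣ : ℕ → List Index → ℕ → ℚ
gΣ N ks t = sumℚ (map (λ k → gN N k t) ks)

-- A sequence of rationals tends to 0.  A finite ℚ-linear combination of
-- (convergent) multiple zeta values equals 0 as a real number iff the same
-- combination of the truncations ζ_N tends to 0 as N → ∞.
TendsToZero : (ℕ → ℚ) → Set
TendsToZero s = ∀ (ε : ℚ) → 0ℚ < ε → ∃ λ M → ∀ N → M ℕ.≤ N → ∣ s N ∣ ≤ ε

-- the two sides (moved to one side) of the two identities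
identity1N : ℕ → ℕ → Index → ℕ → ℕ → ℚ
identity1N k₁ kr middle t N =
  fN N (k₁ ∷ middle ++ [ kr ]) t
    + sumℚ (map (λ u → gΣ N (kU k₁ middle kr u) (t ℕ.∸ u)) (upTo (suc t)))

identity2N : ℕ → ℕ → Index → ℕ → ℕ → ℚ
identity2N k₁ kr middle t N =
  gN N (k₁ ∷ middle ++ [ kr ]) t
    + sumℚ (map (λ u → pow (- 1ℚ) u * fΣ N (kU k₁ middle kr u) (t ℕ.∸ u)) (upTo (suc t)))

-- Both identities are identities between formal sums of indices, so they hold exactly
-- at every truncation level N and the sequences vanish identically.
--
-- Write an index k of weight n as the word toBits k of length n − 1 marking S(k). The
-- summands of f_L(k,t) are then the words obtained by inserting t letters true into the
-- n gaps of this word, those of g_R(k,t) the words obtained by inserting them only just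
-- before letters false and at the end, and the indices of k_u the words obtained by
-- inserting u letters true just after existing ones. Sorting an insertion by the number u
-- of letters placed after a true gives f_L(k,t) = Σ_u g_R(k_u,t−u), while
-- f_R(k,t) = Σ_u g_L(k_u,t−u) is a reindexing; this is the first identity. For the second,
-- (k_u)_v = C(u+v,u) k_{u+v} by associativity of the shuffle, and Σ_u (−1)^u C(n,u) = [n = 0]
-- inverts the first identity.

module Submission where

open import Defs
open import Data.Bool using (Bool; true; false; not)
open import Data.List using (List; []; _∷_; _++_; [_]; map; concatMap; upTo; applyUpTo; replicate; length; zip)
open import Data.List.Properties using (++-assoc; ++-identityʳ; length-replicate; length-++; map-++; map-replicate)
open import Data.List.Relation.Unary.All as All using (All; []; _∷_)
open import Data.List.Relation.Unary.All.Properties using (++⁺; map⁺; replicate⁺)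
open import Data.Nat as ℕ using (ℕ; zero; suc; _≤_; _<_; _∸_; s≤s; z≤n)
import Data.Nat.Properties as ℕₚ
open import Data.Product using (_×_; _,_)
open import Data.Rational as ℚ using (ℚ; 0ℚ; 1ℚ; _+_; _*_; -_; ∣_∣)
open import Data.Rational.Properties
  using (+-identityˡ; +-identityʳ; +-assoc; +-comm; neg-distrib-+;
         *-identityˡ; *-zeroˡ; *-zeroʳ; *-assoc; *-distribˡ-+; *-distribʳ-+; <⇒≤)
open import Data.Rational.Solver using (module +-*-Solver)
open +-*-Solver using (solve; _:+_; _:*_; :-_; _:=_; con)
open import Relation.Binary.PropositionalEquality
  using (_≡_; refl; sym; trans; cong; cong₂; subst; module ≡-Reasoning)

private
  variable
    A B : Set

+-interchange : ∀ a b c d → (a + b) + (c + d) ≡ (a + c) + (b + d)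
+-interchange = solve 4 (λ a b c d → (a :+ b) :+ (c :+ d) := (a :+ c) :+ (b :+ d)) refl

∑ : (A → ℚ) → List A → ℚ
∑ f xs = sumℚ (map f xs)

∑-++ : (f : A → ℚ) (xs ys : List A) → ∑ f (xs ++ ys) ≡ ∑ f xs + ∑ f ys
∑-++ f []       ys = sym (+-identityˡ _)
∑-++ f (x ∷ xs) ys = trans (cong (f x +_) (∑-++ f xs ys)) (sym (+-assoc (f x) _ _))

∑-map : (f : B → ℚ) (g : A → B) (xs : List A) → ∑ f (map g xs) ≡ ∑ (λ x → f (g x)) xs
∑-map f g []       = refl
∑-map f g (x ∷ xs) = cong (f (g x) +_) (∑-map f g xs)

∑-concatMap : (f : B → ℚ) (g : A → List B) (xs : List A) →
              ∑ f (concatMap g xs) ≡ ∑ (λ x → ∑ f (g x)) xs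
∑-concatMap f g []       = refl
∑-concatMap f g (x ∷ xs) =
  trans (∑-++ f (g x) (concatMap g xs)) (cong (∑ f (g x) +_) (∑-concatMap f g xs))

∑-cong : {f g : A → ℚ} (xs : List A) → (∀ x → f x ≡ g x) → ∑ f xs ≡ ∑ g xs
∑-cong []       f≡g = refl
∑-cong (x ∷ xs) f≡g = cong₂ _+_ (f≡g x) (∑-cong xs f≡g)

∑-congᴬ : {f g : A → ℚ} {xs : List A} → All (λ x → f x ≡ g x) xs → ∑ f xs ≡ ∑ g xs
∑-congᴬ []       = refl
∑-congᴬ (p ∷ ps) = cong₂ _+_ p (∑-congᴬ ps)

∑-zero : (xs : List A) → ∑ (λ _ → 0ℚ) xs ≡ 0ℚ
∑-zero []       = refl
∑-zero (x ∷ xs) = trans (+-identityˡ _) (∑-zero xs)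

∑-+ : (f g : A → ℚ) (xs : List A) → ∑ (λ x → f x + g x) xs ≡ ∑ f xs + ∑ g xs
∑-+ f g []       = sym (+-identityˡ 0ℚ)
∑-+ f g (x ∷ xs) = trans (cong (f x + g x +_) (∑-+ f g xs)) (+-interchange (f x) (g x) _ _)

∑-neg : (f : A → ℚ) (xs : List A) → ∑ (λ x → - f x) xs ≡ - ∑ f xs
∑-neg f []       = refl
∑-neg f (x ∷ xs) = trans (cong (- f x +_) (∑-neg f xs)) (sym (neg-distrib-+ (f x) _))

∑-comm : (F : A → B → ℚ) (xs : List A) (ys : List B) →
         ∑ (λ x → ∑ (F x) ys) xs ≡ ∑ (λ y → ∑ (λ x → F x y) xs) ys
∑-comm F []       ys = sym (∑-zero ys)
∑-comm F (x ∷ xs) ys = trans (cong (∑ (F x) ys +_) (∑-comm F xs ys))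
                             (sym (∑-+ (F x) (λ y → ∑ (λ x → F x y) xs) ys))

∑-++-prefixed : (f : List A → ℚ) (x y : A) (xss yss : List (List A)) →
                ∑ f (map (x ∷_) xss ++ map (y ∷_) yss) ≡
                ∑ (λ w → f (x ∷ w)) xss + ∑ (λ w → f (y ∷ w)) yss
∑-++-prefixed f x y xss yss =
  trans (∑-++ f (map (x ∷_) xss) (map (y ∷_) yss))
        (cong₂ _+_ (∑-map f (x ∷_) xss) (∑-map f (y ∷_) yss))

∑< : ℕ → (ℕ → ℚ) → ℚ
∑< zero    F = 0ℚ
∑< (suc n) F = F 0 + ∑< n (λ i → F (suc i))

∑-upTo : (F : ℕ → ℚ) (n : ℕ) → ∑ F (upTo n) ≡ ∑< n F
∑-upTo F n = go F (λ i → i) n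
  where
  go : (F : ℕ → ℚ) (g : ℕ → ℕ) (n : ℕ) → ∑ F (applyUpTo g n) ≡ ∑< n (λ i → F (g i))
  go F g zero    = refl
  go F g (suc n) = cong (F (g 0) +_) (go F (λ i → g (suc i)) n)

∑<-cong : (n : ℕ) {F G : ℕ → ℚ} → (∀ i → F i ≡ G i) → ∑< n F ≡ ∑< n G
∑<-cong zero    F≡G = refl
∑<-cong (suc n) F≡G = cong₂ _+_ (F≡G 0) (∑<-cong n (λ i → F≡G (suc i)))

∑<-cong< : (n : ℕ) {F G : ℕ → ℚ} → (∀ i → i < n → F i ≡ G i) → ∑< n F ≡ ∑< n G
∑<-cong< zero    F≡G = refl
∑<-cong< (suc n) F≡G =
  cong₂ _+_ (F≡G 0 (s≤s z≤n)) (∑<-cong< n (λ i i<n → F≡G (suc i) (s≤s i<n)))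

∑<-zero : (n : ℕ) → ∑< n (λ _ → 0ℚ) ≡ 0ℚ
∑<-zero zero    = refl
∑<-zero (suc n) = trans (+-identityˡ _) (∑<-zero n)

∑<-+ : (n : ℕ) (F G : ℕ → ℚ) → ∑< n (λ i → F i + G i) ≡ ∑< n F + ∑< n G
∑<-+ zero    F G = sym (+-identityˡ 0ℚ)
∑<-+ (suc n) F G = trans (cong (F 0 + G 0 +_) (∑<-+ n _ _)) (+-interchange (F 0) (G 0) _ _)

∑<-neg : (n : ℕ) (F : ℕ → ℚ) → ∑< n (λ i → - F i) ≡ - ∑< n F
∑<-neg zero    F = refl
∑<-neg (suc n) F = trans (cong (- F 0 +_) (∑<-neg n _)) (sym (neg-distrib-+ (F 0) _))

∑<-*ˡ : (n : ℕ) (c : ℚ) (F : ℕ → ℚ) → ∑< n (λ i → c * F i) ≡ c * ∑< n F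
∑<-*ˡ zero    c F = sym (*-zeroʳ c)
∑<-*ˡ (suc n) c F = trans (cong (c * F 0 +_) (∑<-*ˡ n c _)) (sym (*-distribˡ-+ c (F 0) _))

∑<-*ʳ : (n : ℕ) (F : ℕ → ℚ) (c : ℚ) → ∑< n (λ i → F i * c) ≡ ∑< n F * c
∑<-*ʳ zero    F c = sym (*-zeroˡ c)
∑<-*ʳ (suc n) F c = trans (cong (F 0 * c +_) (∑<-*ʳ n _ c)) (sym (*-distribʳ-+ c (F 0) _))

∑<-snoc : (n : ℕ) (F : ℕ → ℚ) → ∑< (suc n) F ≡ ∑< n F + F n
∑<-snoc zero    F = trans (+-identityʳ (F 0)) (sym (+-identityˡ (F 0)))
∑<-snoc (suc n) F = trans (cong (F 0 +_) (∑<-snoc n (λ i → F (suc i)))) (sym (+-assoc (F 0) _ _))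

∑<-+-split : (m n : ℕ) (F : ℕ → ℚ) → ∑< (m ℕ.+ n) F ≡ ∑< m F + ∑< n (λ i → F (m ℕ.+ i))
∑<-+-split zero    n F = sym (+-identityˡ _)
∑<-+-split (suc m) n F =
  trans (cong (F 0 +_) (∑<-+-split m n (λ i → F (suc i)))) (sym (+-assoc (F 0) _ _))

∑<-∑ : (n : ℕ) (F : ℕ → A → ℚ) (xs : List A) →
       ∑< n (λ i → ∑ (F i) xs) ≡ ∑ (λ x → ∑< n (λ i → F i x)) xs
∑<-∑ zero    F xs = sym (∑-zero xs)
∑<-∑ (suc n) F xs = trans (cong (∑ (F 0) xs +_) (∑<-∑ n (λ i → F (suc i)) xs))
                          (sym (∑-+ (F 0) (λ x → ∑< n (λ i → F (suc i) x)) xs))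

∑<-∑-difference : (n : ℕ) (f g : ℕ → A → ℚ) (xs : ℕ → List A) →
  ∑< n (λ i → ∑ (λ x → f i x + - g i x) (xs i)) ≡
  ∑< n (λ i → ∑ (f i) (xs i)) + - ∑< n (λ i → ∑ (g i) (xs i))
∑<-∑-difference n f g xs = begin
  ∑< n (λ i → ∑ (λ x → f i x + - g i x) (xs i))
    ≡⟨ ∑<-cong n (λ i → trans (∑-+ (f i) (λ x → - g i x) (xs i))
                              (cong (∑ (f i) (xs i) +_) (∑-neg (g i) (xs i)))) ⟩
  ∑< n (λ i → ∑ (f i) (xs i) + - ∑ (g i) (xs i))
    ≡⟨ ∑<-+ n (λ i → ∑ (f i) (xs i)) (λ i → - ∑ (g i) (xs i)) ⟩
  ∑< n (λ i → ∑ (f i) (xs i)) + ∑< n (λ i → - ∑ (g i) (xs i))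
    ≡⟨ cong (∑< n (λ i → ∑ (f i) (xs i)) +_) (∑<-neg n (λ i → ∑ (g i) (xs i))) ⟩
  ∑< n (λ i → ∑ (f i) (xs i)) + - ∑< n (λ i → ∑ (g i) (xs i)) ∎
  where open ≡-Reasoning

∑<-reverse : (t : ℕ) (F : ℕ → ℕ → ℚ) →
             ∑< (suc t) (λ i → F i (t ∸ i)) ≡ ∑< (suc t) (λ i → F (t ∸ i) i)
∑<-reverse zero    F = refl
∑<-reverse (suc t) F = begin
  F 0 (suc t) + ∑< (suc t) (λ i → F (suc i) (t ∸ i))
    ≡⟨ cong (F 0 (suc t) +_) (∑<-reverse t (λ i → F (suc i))) ⟩
  F 0 (suc t) + ∑< (suc t) (λ i → F (suc (t ∸ i)) i)
    ≡⟨ +-comm (F 0 (suc t)) _ ⟩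
  ∑< (suc t) (λ i → F (suc (t ∸ i)) i) + F 0 (suc t)
    ≡⟨ cong₂ _+_ (∑<-cong< (suc t) (λ i i≤t →
                   cong (λ z → F z i) (sym (ℕₚ.+-∸-assoc 1 (ℕₚ.≤-pred i≤t)))))
                 (cong (λ z → F z (suc t)) (sym (ℕₚ.n∸n≡0 (suc t)))) ⟩
  ∑< (suc t) (λ i → F (suc t ∸ i) i) + F (suc t ∸ suc t) (suc t)
    ≡⟨ sym (∑<-snoc (suc t) (λ i → F (suc t ∸ i) i)) ⟩
  ∑< (suc (suc t)) (λ i → F (suc t ∸ i) i) ∎
  where open ≡-Reasoning

∑³ : ℕ → (ℕ → ℕ → ℕ → ℚ) → ℚ
∑³ t H = ∑< (suc t) (λ a → ∑< (suc (t ∸ a)) (λ u → H a u (t ∸ a ∸ u)))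

∑³-regroup : (t : ℕ) (H : ℕ → ℕ → ℕ → ℚ) →
             ∑³ t H ≡ ∑< (suc t) (λ s → ∑< (suc s) (λ a → H a (s ∸ a) (t ∸ s)))
∑³-regroup zero    H = refl
∑³-regroup (suc t) H = begin
  (H 0 0 (suc t) + ∑< (suc t) (λ u → H 0 (suc u) (t ∸ u))) + ∑³ t (λ a → H (suc a))
    ≡⟨ cong (H 0 0 (suc t) + ∑< (suc t) (λ u → H 0 (suc u) (t ∸ u)) +_)
            (∑³-regroup t (λ a → H (suc a))) ⟩
  (H 0 0 (suc t) + ∑< (suc t) (λ s → H 0 (suc s) (t ∸ s)))
    + ∑< (suc t) (λ s → ∑< (suc s) (λ a → H (suc a) (s ∸ a) (t ∸ s)))
    ≡⟨ +-assoc (H 0 0 (suc t)) _ _ ⟩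
  H 0 0 (suc t) + (∑< (suc t) (λ s → H 0 (suc s) (t ∸ s))
                   + ∑< (suc t) (λ s → ∑< (suc s) (λ a → H (suc a) (s ∸ a) (t ∸ s))))
    ≡⟨ cong₂ _+_ (sym (+-identityʳ (H 0 0 (suc t))))
                 (sym (∑<-+ (suc t) (λ s → H 0 (suc s) (t ∸ s))
                                    (λ s → ∑< (suc s) (λ a → H (suc a) (s ∸ a) (t ∸ s))))) ⟩
  (H 0 0 (suc t) + 0ℚ)
    + ∑< (suc t) (λ s → H 0 (suc s) (t ∸ s) + ∑< (suc s) (λ a → H (suc a) (s ∸ a) (t ∸ s))) ∎
  where open ≡-Reasoning

∑³-swap : (t : ℕ) (H : ℕ → ℕ → ℕ → ℚ) → ∑³ t H ≡ ∑³ t (λ u a → H a u)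
∑³-swap t H = begin
  ∑³ t H
    ≡⟨ ∑³-regroup t H ⟩
  ∑< (suc t) (λ s → ∑< (suc s) (λ a → H a (s ∸ a) (t ∸ s)))
    ≡⟨ ∑<-cong (suc t) (λ s → ∑<-reverse s (λ a u → H a u (t ∸ s))) ⟩
  ∑< (suc t) (λ s → ∑< (suc s) (λ u → H (s ∸ u) u (t ∸ s)))
    ≡⟨ sym (∑³-regroup t (λ u a → H a u)) ⟩
  ∑³ t (λ u a → H a u) ∎
  where open ≡-Reasoning

∑<-vanishing-tail : (n m : ℕ) (F : ℕ → ℚ) → (∀ i → i < m → F (n ℕ.+ i) ≡ 0ℚ) →
                    ∑< (n ℕ.+ m) F ≡ ∑< n F
∑<-vanishing-tail n m F tail≡0 = begin
  ∑< (n ℕ.+ m) F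
    ≡⟨ ∑<-+-split n m F ⟩
  ∑< n F + ∑< m (λ i → F (n ℕ.+ i))
    ≡⟨ cong (∑< n F +_) (trans (∑<-cong< m tail≡0) (∑<-zero m)) ⟩
  ∑< n F + 0ℚ
    ≡⟨ +-identityʳ _ ⟩
  ∑< n F ∎
  where open ≡-Reasoning

n+m∸[1+n+i]<m : ∀ n m i → 0 < m → n ℕ.+ m ∸ (suc n ℕ.+ i) < m
n+m∸[1+n+i]<m n (suc m) i _ = begin-strict
  n ℕ.+ suc m ∸ (suc n ℕ.+ i)   ≡⟨ cong (n ℕ.+ suc m ∸_) (sym (ℕₚ.+-suc n i)) ⟩
  n ℕ.+ suc m ∸ (n ℕ.+ suc i)   ≡⟨ ℕₚ.[m+n]∸[m+o]≡n∸o n (suc m) (suc i) ⟩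
  m ∸ i                         ≤⟨ ℕₚ.m∸n≤m m i ⟩
  m                             <⟨ ℕₚ.n<1+n m ⟩
  suc m                         ∎
  where open ℕₚ.≤-Reasoning

∑-wcomps-suc : (F : Index → ℚ) (m s : ℕ) →
               ∑ F (wcomps (suc m) s) ≡ ∑< (suc s) (λ a → ∑ (λ e → F (a ∷ e)) (wcomps m (s ∸ a)))
∑-wcomps-suc F m s = begin
  ∑ F (concatMap (λ a → map (a ∷_) (wcomps m (s ∸ a))) (upTo (suc s)))
    ≡⟨ ∑-concatMap F (λ a → map (a ∷_) (wcomps m (s ∸ a))) (upTo (suc s)) ⟩
  ∑ (λ a → ∑ F (map (a ∷_) (wcomps m (s ∸ a)))) (upTo (suc s))
    ≡⟨ ∑-upTo (λ a → ∑ F (map (a ∷_) (wcomps m (s ∸ a)))) (suc s) ⟩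
  ∑< (suc s) (λ a → ∑ F (map (a ∷_) (wcomps m (s ∸ a))))
    ≡⟨ ∑<-cong (suc s) (λ a → ∑-map F (a ∷_) (wcomps m (s ∸ a))) ⟩
  ∑< (suc s) (λ a → ∑ (λ e → F (a ∷ e)) (wcomps m (s ∸ a))) ∎
  where open ≡-Reasoning

∑-wcomps-one : (F : Index → ℚ) (t : ℕ) → ∑ F (wcomps 1 t) ≡ F [ t ]
∑-wcomps-one F t = trans (∑-wcomps-suc F 0 t) (last t (λ a e → F (a ∷ e)))
  where
  last : (t : ℕ) (H : ℕ → Index → ℚ) → ∑< (suc t) (λ a → ∑ (H a) (wcomps 0 (t ∸ a))) ≡ H t []
  last zero    H = trans (+-identityʳ _) (+-identityʳ _)
  last (suc t) H = trans (+-identityˡ _) (last t (λ a → H (suc a)))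

∑-wcomps-cong : (m s : ℕ) {F G : Index → ℚ} → (∀ e → length e ≡ m → F e ≡ G e) →
                ∑ F (wcomps m s) ≡ ∑ G (wcomps m s)
∑-wcomps-cong zero    zero    F≡G = cong (_+ 0ℚ) (F≡G [] refl)
∑-wcomps-cong zero    (suc s) F≡G = refl
∑-wcomps-cong (suc m) s {F} {G} F≡G = begin
  ∑ F (wcomps (suc m) s)
    ≡⟨ ∑-wcomps-suc F m s ⟩
  ∑< (suc s) (λ a → ∑ (λ e → F (a ∷ e)) (wcomps m (s ∸ a)))
    ≡⟨ ∑<-cong (suc s) (λ a →
         ∑-wcomps-cong m (s ∸ a) (λ e ∣e∣ → F≡G (a ∷ e) (cong suc ∣e∣))) ⟩
  ∑< (suc s) (λ a → ∑ (λ e → G (a ∷ e)) (wcomps m (s ∸ a)))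
    ≡⟨ sym (∑-wcomps-suc G m s) ⟩
  ∑ G (wcomps (suc m) s) ∎
  where open ≡-Reasoning

∑-wcomps-+ : (F : Index → ℚ) (p q t : ℕ) →
  ∑ F (wcomps (p ℕ.+ q) t) ≡
  ∑< (suc t) (λ a → ∑ (λ e₁ → ∑ (λ e₂ → F (e₁ ++ e₂)) (wcomps q (t ∸ a))) (wcomps p a))
∑-wcomps-+ F zero    q t =
  sym (trans (cong₂ _+_ (+-identityʳ (∑ F (wcomps q t))) (∑<-zero t)) (+-identityʳ _))
∑-wcomps-+ F (suc p) q t = begin
  ∑ F (wcomps (suc (p ℕ.+ q)) t)
    ≡⟨ ∑-wcomps-suc F (p ℕ.+ q) t ⟩
  ∑< (suc t) (λ b → ∑ (λ e → F (b ∷ e)) (wcomps (p ℕ.+ q) (t ∸ b)))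
    ≡⟨ ∑<-cong (suc t) (λ b → ∑-wcomps-+ (λ e → F (b ∷ e)) p q (t ∸ b)) ⟩
  ∑³ t H
    ≡⟨ ∑³-regroup t H ⟩
  ∑< (suc t) (λ s → ∑< (suc s) (λ b → H b (s ∸ b) (t ∸ s)))
    ≡⟨ ∑<-cong (suc t) (λ s →
         sym (∑-wcomps-suc (λ e₁ → ∑ (λ e₂ → F (e₁ ++ e₂)) (wcomps q (t ∸ s))) p s)) ⟩
  ∑< (suc t) (λ a → ∑ (λ e₁ → ∑ (λ e₂ → F (e₁ ++ e₂)) (wcomps q (t ∸ a)))
                        (wcomps (suc p) a)) ∎
  where
  open ≡-Reasoning
  H : ℕ → ℕ → ℕ → ℚ
  H b a r = ∑ (λ e₁ → ∑ (λ e₂ → F (b ∷ e₁ ++ e₂)) (wcomps q r)) (wcomps p a)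

∑-comps-suc : (F : Index → ℚ) (m s : ℕ) →
              ∑ F (comps (suc m) s) ≡ ∑< s (λ a → ∑ (λ c → F (suc a ∷ c)) (comps m (s ∸ suc a)))
∑-comps-suc F m s = begin
  ∑ F (concatMap (λ a → map (suc a ∷_) (comps m (s ∸ suc a))) (upTo s))
    ≡⟨ ∑-concatMap F (λ a → map (suc a ∷_) (comps m (s ∸ suc a))) (upTo s) ⟩
  ∑ (λ a → ∑ F (map (suc a ∷_) (comps m (s ∸ suc a)))) (upTo s)
    ≡⟨ ∑-upTo (λ a → ∑ F (map (suc a ∷_) (comps m (s ∸ suc a)))) s ⟩
  ∑< s (λ a → ∑ F (map (suc a ∷_) (comps m (s ∸ suc a))))
    ≡⟨ ∑<-cong s (λ a → ∑-map F (suc a ∷_) (comps m (s ∸ suc a))) ⟩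
  ∑< s (λ a → ∑ (λ c → F (suc a ∷ c)) (comps m (s ∸ suc a))) ∎
  where open ≡-Reasoning

∑-comps-< : (F : Index → ℚ) (m s : ℕ) → s < m → ∑ F (comps m s) ≡ 0ℚ
∑-comps-< F (suc m) s (s≤s s≤m) = trans (∑-comps-suc F m s)
  (trans (∑<-cong< s (λ a a<s → ∑-comps-< (λ c → F (suc a ∷ c)) m (s ∸ suc a)
                                  (ℕₚ.<-≤-trans (ℕₚ.∸-monoʳ-< {m = s} (s≤s z≤n) a<s) s≤m)))
         (∑<-zero s))

∑-comps-wcomps : (F : Index → ℚ) (m t : ℕ) →
                 ∑ F (comps m (m ℕ.+ t)) ≡ ∑ (λ e → F (map suc e)) (wcomps m t)
∑-comps-wcomps F zero    zero    = refl
∑-comps-wcomps F zero    (suc t) = refl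
∑-comps-wcomps F (suc m) t = begin
  ∑ F (comps (suc m) (suc m ℕ.+ t))
    ≡⟨ ∑-comps-suc F m (suc m ℕ.+ t) ⟩
  ∑< (suc (m ℕ.+ t)) K
    ≡⟨ cong (λ n → ∑< (suc n) K) (ℕₚ.+-comm m t) ⟩
  ∑< (suc t ℕ.+ m) K
    ≡⟨ ∑<-vanishing-tail (suc t) m K (λ i i<m → ∑-comps-< _ m _ (tail-small i i<m)) ⟩
  ∑< (suc t) K
    ≡⟨ ∑<-cong< (suc t) (λ a a≤t →
         trans (cong (λ s → ∑ (λ c → F (suc a ∷ c)) (comps m s))
                     (ℕₚ.+-∸-assoc m (ℕₚ.≤-pred a≤t)))
               (∑-comps-wcomps (λ c → F (suc a ∷ c)) m (t ∸ a))) ⟩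
  ∑< (suc t) (λ a → ∑ (λ e → F (suc a ∷ map suc e)) (wcomps m (t ∸ a)))
    ≡⟨ sym (∑-wcomps-suc (λ e → F (map suc e)) m t) ⟩
  ∑ (λ e → F (map suc e)) (wcomps (suc m) t) ∎
  where
  open ≡-Reasoning
  K : ℕ → ℚ
  K a = ∑ (λ c → F (suc a ∷ c)) (comps m (m ℕ.+ t ∸ a))
  tail-small : ∀ i → i < m → m ℕ.+ t ∸ (suc t ℕ.+ i) < m
  tail-small i i<m = subst (λ n → n ∸ (suc t ℕ.+ i) < m) (ℕₚ.+-comm t m)
                           (n+m∸[1+n+i]<m t m i (ℕₚ.<-≤-trans (s≤s z≤n) i<m))

replicate-+-++ : (m n : ℕ) (x : A) (xs : List A) →
                 replicate (m ℕ.+ n) x ++ xs ≡ replicate m x ++ replicate n x ++ xs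
replicate-+-++ zero    n x xs = refl
replicate-+-++ (suc m) n x xs = cong (x ∷_) (replicate-+-++ m n x xs)

replicate-suc-++ : (n : ℕ) (x : A) (xs : List A) → replicate (suc n) x ++ xs ≡ replicate n x ++ x ∷ xs
replicate-suc-++ zero    x xs = refl
replicate-suc-++ (suc n) x xs = cong (x ∷_) (replicate-suc-++ n x xs)

trues falses : ℕ → List Bool
trues n  = replicate n true
falses n = replicate n false

#true #false : List Bool → ℕ
#true []          = 0
#true (true ∷ w)  = suc (#true w)
#true (false ∷ w) = #true w
#false []          = 0
#false (true ∷ w)  = #false w
#false (false ∷ w) = suc (#false w)

#true-falses-++ : (n : ℕ) (w : List Bool) → #true (falses n ++ w) ≡ #true w
#true-falses-++ zero    w = refl
#true-falses-++ (suc n) w = #true-falses-++ n w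

#false-trues-++ : (n : ℕ) (w : List Bool) → #false (trues n ++ w) ≡ #false w
#false-trues-++ zero    w = refl
#false-trues-++ (suc n) w = #false-trues-++ n w

#true-map-not : (w : List Bool) → #true (map not w) ≡ #false w
#true-map-not []          = refl
#true-map-not (true ∷ w)  = #true-map-not w
#true-map-not (false ∷ w) = cong suc (#true-map-not w)

-- A word w has |w| + 1 gaps, one before each letter and one at the end; the entries of
-- e are the numbers of letters inserted into the gaps concerned, from left to right.
insTrues : List Bool → Index → List Bool
insTrues []      []       = []
insTrues []      (e ∷ _)  = trues e
insTrues (b ∷ w) []       = b ∷ insTrues w []
insTrues (b ∷ w) (e ∷ es) = trues e ++ b ∷ insTrues w es

insTruesBeforeFalses : List Bool → Index → List Bool
insTruesBeforeFalses []          []       = []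
insTruesBeforeFalses []          (e ∷ _)  = trues e
insTruesBeforeFalses (true ∷ w)  es       = true ∷ insTruesBeforeFalses w es
insTruesBeforeFalses (false ∷ w) []       = false ∷ insTruesBeforeFalses w []
insTruesBeforeFalses (false ∷ w) (e ∷ es) = trues e ++ false ∷ insTruesBeforeFalses w es

insFalsesBeforeTrues : List Bool → Index → List Bool
insFalsesBeforeTrues []          []       = []
insFalsesBeforeTrues []          (e ∷ _)  = falses e
insFalsesBeforeTrues (false ∷ w) es       = false ∷ insFalsesBeforeTrues w es
insFalsesBeforeTrues (true ∷ w)  []       = true ∷ insFalsesBeforeTrues w []
insFalsesBeforeTrues (true ∷ w)  (e ∷ es) = falses e ++ true ∷ insFalsesBeforeTrues w es

insTruesAfterTrues : List Bool → Index → List Bool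
insTruesAfterTrues []          _        = []
insTruesAfterTrues (false ∷ w) ms       = false ∷ insTruesAfterTrues w ms
insTruesAfterTrues (true ∷ w)  []       = true ∷ insTruesAfterTrues w []
insTruesAfterTrues (true ∷ w)  (m ∷ ms) = true ∷ trues m ++ insTruesAfterTrues w ms

sumInsTrues : (List Bool → ℚ) → List Bool → ℕ → ℚ
sumInsTrues G w t = ∑ (λ e → G (insTrues w e)) (wcomps (suc (length w)) t)

insTrues-++ : (v : List Bool) (b : Bool) (w : List Bool) (e₁ e₂ : Index) → length e₁ ≡ suc (length v) →
              insTrues (v ++ b ∷ w) (e₁ ++ e₂) ≡ insTrues v e₁ ++ b ∷ insTrues w e₂
insTrues-++ []      b w (e ∷ [])     e₂ _ = refl
insTrues-++ (a ∷ v) b w (e ∷ e₁) e₂ ∣e₁∣ =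
  trans (cong (λ x → trues e ++ a ∷ x) (insTrues-++ v b w e₁ e₂ (ℕₚ.suc-injective ∣e₁∣)))
        (sym (++-assoc (trues e) (a ∷ insTrues v e₁) (b ∷ insTrues w e₂)))

insTruesBeforeFalses-trues-++ : (n : ℕ) (w : List Bool) (e : Index) →
  insTruesBeforeFalses (trues n ++ w) e ≡ trues n ++ insTruesBeforeFalses w e
insTruesBeforeFalses-trues-++ zero    w e = refl
insTruesBeforeFalses-trues-++ (suc n) w e = cong (true ∷_) (insTruesBeforeFalses-trues-++ n w e)

insTruesAfterTrues-falses-++ : (n : ℕ) (w : List Bool) (m : Index) →
  insTruesAfterTrues (falses n ++ w) m ≡ falses n ++ insTruesAfterTrues w m
insTruesAfterTrues-falses-++ zero    w m = refl
insTruesAfterTrues-falses-++ (suc n) w m = cong (false ∷_) (insTruesAfterTrues-falses-++ n w m)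

#false-insTruesAfterTrues : (w : List Bool) (m : Index) → #false (insTruesAfterTrues w m) ≡ #false w
#false-insTruesAfterTrues []          m        = refl
#false-insTruesAfterTrues (false ∷ w) m        = cong suc (#false-insTruesAfterTrues w m)
#false-insTruesAfterTrues (true ∷ w)  []       = #false-insTruesAfterTrues w []
#false-insTruesAfterTrues (true ∷ w)  (m ∷ ms) =
  trans (#false-trues-++ m (insTruesAfterTrues w ms)) (#false-insTruesAfterTrues w ms)

map-not-insFalsesBeforeTrues : (w : List Bool) (e : Index) →
  map not (insFalsesBeforeTrues (map not w) e) ≡ insTruesBeforeFalses w e
map-not-insFalsesBeforeTrues []          []       = refl
map-not-insFalsesBeforeTrues []          (e ∷ _)  = map-replicate not e false
map-not-insFalsesBeforeTrues (true ∷ w)  e        = cong (true ∷_) (map-not-insFalsesBeforeTrues w e)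
map-not-insFalsesBeforeTrues (false ∷ w) []       = cong (false ∷_) (map-not-insFalsesBeforeTrues w [])
map-not-insFalsesBeforeTrues (false ∷ w) (e ∷ es) = begin
  map not (falses e ++ true ∷ insFalsesBeforeTrues (map not w) es)
    ≡⟨ map-++ not (falses e) _ ⟩
  map not (falses e) ++ false ∷ map not (insFalsesBeforeTrues (map not w) es)
    ≡⟨ cong₂ (λ x y → x ++ false ∷ y) (map-replicate not e false) (map-not-insFalsesBeforeTrues w es) ⟩
  trues e ++ false ∷ insTruesBeforeFalses w es ∎
  where open ≡-Reasoning

∑-insTrues-split : (w : List Bool) (t : ℕ) (G : List Bool → ℚ) →
  sumInsTrues G w t ≡
  ∑< (suc t) (λ u → ∑ (λ m → ∑ (λ e → G (insTruesBeforeFalses (insTruesAfterTrues w m) e))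
                                (wcomps (suc (#false w)) (t ∸ u)))
                      (wcomps (#true w) u))
∑-insTrues-split [] t G = begin
  ∑ (λ e → G (insTrues [] e)) (wcomps 1 t)
    ≡⟨ ∑-wcomps-one _ t ⟩
  G (trues t)
    ≡⟨ sym (trans (cong₂ _+_ (+-identityʳ (G (trues t))) (∑<-zero t)) (+-identityʳ _)) ⟩
  (G (trues t) + 0ℚ) + ∑< t (λ _ → 0ℚ)
    ≡⟨ cong (λ x → (x + 0ℚ) + ∑< t (λ _ → 0ℚ)) (sym (∑-wcomps-one _ t)) ⟩
  (∑ (λ e → G (insTruesBeforeFalses [] e)) (wcomps 1 t) + 0ℚ) + ∑< t (λ _ → 0ℚ) ∎
  where open ≡-Reasoning
∑-insTrues-split (false ∷ w) t G = begin
  ∑ (λ e → G (insTrues (false ∷ w) e)) (wcomps (suc (suc (length w))) t)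
    ≡⟨ ∑-wcomps-suc (λ e → G (insTrues (false ∷ w) e)) (suc (length w)) t ⟩
  ∑< (suc t) (λ a → ∑ (λ e → G (trues a ++ false ∷ insTrues w e)) (wcomps (suc (length w)) (t ∸ a)))
    ≡⟨ ∑<-cong (suc t) (λ a → ∑-insTrues-split w (t ∸ a) (λ v → G (trues a ++ false ∷ v))) ⟩
  ∑³ t (λ a u → H u a)
    ≡⟨ ∑³-swap t (λ a u → H u a) ⟩
  ∑³ t H
    ≡⟨ ∑<-cong (suc t) (λ u →
         ∑<-∑ (suc (t ∸ u)) (λ a m → ∑ (λ e → G′ a (ins m e)) (wcomps (suc (#false w)) (t ∸ u ∸ a)))
              (wcomps (#true w) u)) ⟩
  ∑< (suc t) (λ u → ∑ (λ m → ∑< (suc (t ∸ u)) (λ a →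
                               ∑ (λ e → G′ a (ins m e)) (wcomps (suc (#false w)) (t ∸ u ∸ a))))
                      (wcomps (#true w) u))
    ≡⟨ ∑<-cong (suc t) (λ u → ∑-cong (wcomps (#true w) u) (λ m →
         sym (∑-wcomps-suc (λ e → G (insTruesBeforeFalses (false ∷ insTruesAfterTrues w m) e))
                           (suc (#false w)) (t ∸ u)))) ⟩
  ∑< (suc t) (λ u → ∑ (λ m → R m (t ∸ u)) (wcomps (#true w) u)) ∎
  where
  open ≡-Reasoning
  ins : Index → Index → List Bool
  ins m e = insTruesBeforeFalses (insTruesAfterTrues w m) e
  G′ : ℕ → List Bool → ℚ
  G′ a v = G (trues a ++ false ∷ v)
  H : ℕ → ℕ → ℕ → ℚ
  H u a r = ∑ (λ m → ∑ (λ e → G′ a (ins m e)) (wcomps (suc (#false w)) r)) (wcomps (#true w) u)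
  R : Index → ℕ → ℚ
  R m s = ∑ (λ e → G (insTruesBeforeFalses (insTruesAfterTrues (false ∷ w) m) e))
            (wcomps (suc (suc (#false w))) s)
∑-insTrues-split (true ∷ w) t G = begin
  ∑ (λ e → G (insTrues (true ∷ w) e)) (wcomps (suc (suc (length w))) t)
    ≡⟨ ∑-wcomps-suc (λ e → G (insTrues (true ∷ w) e)) (suc (length w)) t ⟩
  ∑< (suc t) (λ a → ∑ (λ e → G (trues a ++ true ∷ insTrues w e)) (wcomps (suc (length w)) (t ∸ a)))
    ≡⟨ ∑<-cong (suc t) (λ a → ∑-insTrues-split w (t ∸ a) (λ v → G (trues a ++ true ∷ v))) ⟩
  ∑³ t H
    ≡⟨ ∑³-regroup t H ⟩
  ∑< (suc t) (λ s → ∑< (suc s) (λ a → H a (s ∸ a) (t ∸ s)))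
    ≡⟨ ∑<-cong (suc t) (λ s → ∑<-cong (suc s) (λ a → ∑-cong (wcomps (#true w) (s ∸ a)) (λ m →
         ∑-cong (wcomps (suc (#false w)) (t ∸ s)) (λ e → cong G (trues-before-true a m e))))) ⟩
  ∑< (suc t) (λ s → ∑< (suc s) (λ a → ∑ (λ m → R (a ∷ m) (t ∸ s)) (wcomps (#true w) (s ∸ a))))
    ≡⟨ ∑<-cong (suc t) (λ s → sym (∑-wcomps-suc (λ m → R m (t ∸ s)) (#true w) s)) ⟩
  ∑< (suc t) (λ u → ∑ (λ m → R m (t ∸ u)) (wcomps (suc (#true w)) u)) ∎
  where
  open ≡-Reasoning
  ins : Index → Index → List Bool
  ins m e = insTruesBeforeFalses (insTruesAfterTrues w m) e
  H : ℕ → ℕ → ℕ → ℚ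
  H a u r = ∑ (λ m → ∑ (λ e → G (trues a ++ true ∷ ins m e)) (wcomps (suc (#false w)) r))
              (wcomps (#true w) u)
  R : Index → ℕ → ℚ
  R m s = ∑ (λ e → G (insTruesBeforeFalses (insTruesAfterTrues (true ∷ w) m) e))
            (wcomps (suc (#false w)) s)
  trues-before-true : ∀ a m e →
    trues a ++ true ∷ ins m e ≡ insTruesBeforeFalses (insTruesAfterTrues (true ∷ w) (a ∷ m)) e
  trues-before-true a m e = begin
    trues a ++ true ∷ ins m e
      ≡⟨ sym (replicate-suc-++ a true (ins m e)) ⟩
    true ∷ trues a ++ ins m e
      ≡⟨ cong (true ∷_) (sym (insTruesBeforeFalses-trues-++ a (insTruesAfterTrues w m) e)) ⟩
    true ∷ insTruesBeforeFalses (trues a ++ insTruesAfterTrues w m) e ∎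

commaBits : Index → List Bool
commaBits []       = []
commaBits (k ∷ ks) = true ∷ toBits (k ∷ ks)

toBits-∷ : (k : ℕ) (ks : Index) → toBits (k ∷ ks) ≡ falses (k ∸ 1) ++ commaBits ks
toBits-∷ k []        = sym (++-identityʳ (falses (k ∸ 1)))
toBits-∷ k (k′ ∷ ks) = refl

commaBits-nonempty : {n : ℕ} (ks : Index) → length ks ≡ suc n → commaBits ks ≡ true ∷ toBits ks
commaBits-nonempty (k ∷ ks) _ = refl

length-fromBitsFrom : (c : ℕ) (w : List Bool) → length (fromBitsFrom c w) ≡ suc (#true w)
length-fromBitsFrom c []          = refl
length-fromBitsFrom c (true ∷ w)  = cong suc (length-fromBitsFrom 1 w)
length-fromBitsFrom c (false ∷ w) = length-fromBitsFrom (suc c) w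

length-dual : (k : Index) → length (dual k) ≡ suc (#false (toBits k))
length-dual k = trans (length-fromBitsFrom 1 (map not (toBits k))) (cong suc (#true-map-not (toBits k)))

length-addE : (ks e : Index) → length ks ≡ length e → length (addE ks e) ≡ length ks
length-addE []       e        _       = refl
length-addE (k ∷ ks) (x ∷ e) ∣ks∣≡∣e∣ =
  cong suc (length-addE ks e (ℕₚ.suc-injective ∣ks∣≡∣e∣))

toBits-addE-fromBitsFrom : (c : ℕ) (w : List Bool) (e : Index) → length e ≡ suc (#true w) →
  toBits (addE (fromBitsFrom (suc c) w) e) ≡ falses c ++ insFalsesBeforeTrues w e
toBits-addE-fromBitsFrom c [] (e ∷ []) _ = begin
  falses (c ℕ.+ e)              ≡⟨ sym (++-identityʳ _) ⟩
  falses (c ℕ.+ e) ++ []        ≡⟨ replicate-+-++ c e false [] ⟩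
  falses c ++ falses e ++ []    ≡⟨ cong (falses c ++_) (++-identityʳ _) ⟩
  falses c ++ falses e          ∎
  where open ≡-Reasoning
toBits-addE-fromBitsFrom c (true ∷ w) (e ∷ es) ∣e∣ = begin
  toBits ((suc c ℕ.+ e) ∷ rest)
    ≡⟨ toBits-∷ (suc c ℕ.+ e) rest ⟩
  falses (c ℕ.+ e) ++ commaBits rest
    ≡⟨ cong (falses (c ℕ.+ e) ++_) (commaBits-nonempty rest ∣rest∣) ⟩
  falses (c ℕ.+ e) ++ true ∷ toBits rest
    ≡⟨ cong (λ x → falses (c ℕ.+ e) ++ true ∷ x) (toBits-addE-fromBitsFrom 0 w es ∣es∣) ⟩
  falses (c ℕ.+ e) ++ true ∷ insFalsesBeforeTrues w es
    ≡⟨ replicate-+-++ c e false _ ⟩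
  falses c ++ insFalsesBeforeTrues (true ∷ w) (e ∷ es) ∎
  where
  open ≡-Reasoning
  rest : Index
  rest = addE (fromBitsFrom 1 w) es
  ∣es∣ : length es ≡ suc (#true w)
  ∣es∣ = ℕₚ.suc-injective ∣e∣
  ∣rest∣ : length rest ≡ suc (#true w)
  ∣rest∣ = trans (length-addE (fromBitsFrom 1 w) es (trans (length-fromBitsFrom 1 w) (sym ∣es∣)))
                 (length-fromBitsFrom 1 w)
toBits-addE-fromBitsFrom c (false ∷ w) e ∣e∣ =
  trans (toBits-addE-fromBitsFrom (suc c) w e ∣e∣) (replicate-suc-++ c false (insFalsesBeforeTrues w e))

dual-addE-dual : (k e : Index) → length e ≡ length (dual k) →
                 dual (addE (dual k) e) ≡ fromBits (insTruesBeforeFalses (toBits k) e)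
dual-addE-dual k e ∣e∣ = cong fromBits (begin
  map not (toBits (addE (fromBitsFrom 1 (map not (toBits k))) e))
    ≡⟨ cong (map not) (toBits-addE-fromBitsFrom 0 (map not (toBits k)) e
                         (trans ∣e∣ (length-fromBitsFrom 1 (map not (toBits k))))) ⟩
  map not (insFalsesBeforeTrues (map not (toBits k)) e)
    ≡⟨ map-not-insFalsesBeforeTrues (toBits k) e ⟩
  insTruesBeforeFalses (toBits k) e ∎)
  where open ≡-Reasoning

sumInsTruesBeforeFalses : (List Bool → ℚ) → List Bool → ℕ → ℚ
sumInsTruesBeforeFalses G w t = ∑ (λ e → G (insTruesBeforeFalses w e)) (wcomps (suc (#false w)) t)

gRN-insTruesBeforeFalses : (N : ℕ) (k : Index) (t : ℕ) →
  gRN N k t ≡ sumInsTruesBeforeFalses (λ v → zetaPlusN N (fromBits v)) (toBits k) t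
gRN-insTruesBeforeFalses N k t = trans
  (∑-wcomps-cong (length (dual k)) t (λ e ∣e∣ → cong (zetaPlusN N) (dual-addE-dual k e ∣e∣)))
  (cong (λ m → ∑ (λ e → zetaPlusN N (fromBits (insTruesBeforeFalses (toBits k) e))) (wcomps m t))
        (length-dual k))

fromBitsFrom-falses : (c n : ℕ) → fromBitsFrom c (falses n) ≡ [ n ℕ.+ c ]
fromBitsFrom-falses c zero    = refl
fromBitsFrom-falses c (suc n) = trans (fromBitsFrom-falses (suc c) n) (cong [_] (ℕₚ.+-suc n c))

fromBitsFrom-++-true : (c : ℕ) (v w : List Bool) →
                       fromBitsFrom c (v ++ true ∷ w) ≡ fromBitsFrom c v ++ fromBits w
fromBitsFrom-++-true c []          w = refl
fromBitsFrom-++-true c (true ∷ v)  w = cong (c ∷_) (fromBitsFrom-++-true 1 v w)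
fromBitsFrom-++-true c (false ∷ v) w = fromBitsFrom-++-true (suc c) v w

fromBits-falses-true : (n : ℕ) (w : List Bool) → fromBits (falses n ++ true ∷ w) ≡ suc n ∷ fromBits w
fromBits-falses-true n w =
  trans (fromBitsFrom-++-true 1 (falses n) w)
        (cong (_++ fromBits w) (trans (fromBitsFrom-falses 1 n) (cong [_] (ℕₚ.+-comm n 1))))

wordsWith : ℕ → ℕ → List (List Bool)
wordsWith zero    a       = [ trues a ]
wordsWith (suc p) zero    = [ falses (suc p) ]
wordsWith (suc p) (suc a) = map (false ∷_) (wordsWith p (suc a)) ++ map (true ∷_) (wordsWith (suc p) a)

∑-wordsWith-zero : (G : List Bool → ℚ) (p : ℕ) → ∑ G (wordsWith p 0) ≡ G (falses p)
∑-wordsWith-zero G zero    = +-identityʳ _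
∑-wordsWith-zero G (suc p) = +-identityʳ _

∑-wordsWith-first-false : (G : List Bool → ℚ) (p a : ℕ) →
  ∑ G (wordsWith (suc p) a) ≡
  ∑< (suc a) (λ b → ∑ (λ w → G (trues b ++ false ∷ w)) (wordsWith p (a ∸ b)))
∑-wordsWith-first-false G p zero =
  trans (∑-wordsWith-zero G (suc p))
        (sym (trans (+-identityʳ _) (∑-wordsWith-zero (λ w → G (false ∷ w)) p)))
∑-wordsWith-first-false G p (suc a) =
  trans (∑-++-prefixed G false true (wordsWith p (suc a)) (wordsWith (suc p) a))
        (cong (∑ (λ w → G (false ∷ w)) (wordsWith p (suc a)) +_)
              (∑-wordsWith-first-false (λ w → G (true ∷ w)) p a))

∑-wordsWith-first-true : (G : List Bool → ℚ) (p a : ℕ) →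
  ∑ G (wordsWith p (suc a)) ≡
  ∑< (suc p) (λ b → ∑ (λ w → G (falses b ++ true ∷ w)) (wordsWith (p ∸ b) a))
∑-wordsWith-first-true G zero    a = sym (+-identityʳ _)
∑-wordsWith-first-true G (suc p) a = begin
  ∑ G (map (false ∷_) (wordsWith p (suc a)) ++ map (true ∷_) (wordsWith (suc p) a))
    ≡⟨ ∑-++-prefixed G false true (wordsWith p (suc a)) (wordsWith (suc p) a) ⟩
  ∑ (λ w → G (false ∷ w)) (wordsWith p (suc a)) + ∑ (λ w → G (true ∷ w)) (wordsWith (suc p) a)
    ≡⟨ cong (_+ ∑ (λ w → G (true ∷ w)) (wordsWith (suc p) a))
            (∑-wordsWith-first-true (λ w → G (false ∷ w)) p a) ⟩
  ∑< (suc p) (λ b → ∑ (λ w → G (false ∷ falses b ++ true ∷ w)) (wordsWith (p ∸ b) a))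
    + ∑ (λ w → G (true ∷ w)) (wordsWith (suc p) a)
    ≡⟨ +-comm (∑< (suc p) (λ b → ∑ (λ w → G (false ∷ falses b ++ true ∷ w)) (wordsWith (p ∸ b) a)))
              (∑ (λ w → G (true ∷ w)) (wordsWith (suc p) a)) ⟩
  ∑ (λ w → G (true ∷ w)) (wordsWith (suc p) a)
    + ∑< (suc p) (λ b → ∑ (λ w → G (false ∷ falses b ++ true ∷ w)) (wordsWith (p ∸ b) a)) ∎
  where open ≡-Reasoning

∑-insTrues-falses : (G : List Bool → ℚ) (p a : ℕ) →
  ∑ (λ e → G (insTrues (falses p) e)) (wcomps (suc p) a) ≡ ∑ G (wordsWith p a)
∑-insTrues-falses G zero    a = trans (∑-wcomps-one _ a) (sym (+-identityʳ _))
∑-insTrues-falses G (suc p) a = begin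
  ∑ (λ e → G (insTrues (falses (suc p)) e)) (wcomps (suc (suc p)) a)
    ≡⟨ ∑-wcomps-suc (λ e → G (insTrues (falses (suc p)) e)) (suc p) a ⟩
  ∑< (suc a) (λ b → ∑ (λ e → G (trues b ++ false ∷ insTrues (falses p) e)) (wcomps (suc p) (a ∸ b)))
    ≡⟨ ∑<-cong (suc a) (λ b → ∑-insTrues-falses (λ w → G (trues b ++ false ∷ w)) p (a ∸ b)) ⟩
  ∑< (suc a) (λ b → ∑ (λ w → G (trues b ++ false ∷ w)) (wordsWith p (a ∸ b)))
    ≡⟨ sym (∑-wordsWith-first-false G p a) ⟩
  ∑ G (wordsWith (suc p) a) ∎
  where open ≡-Reasoning

∑-comps-one : (F : Index → ℚ) (s : ℕ) → ∑ F (comps 1 (suc s)) ≡ F [ suc s ]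
∑-comps-one F s = trans (∑-comps-suc F 0 (suc s)) (last s (λ a c → F (suc a ∷ c)))
  where
  last : (s : ℕ) (H : ℕ → Index → ℚ) → ∑< (suc s) (λ a → ∑ (H a) (comps 0 (s ∸ a))) ≡ H s []
  last zero    H = trans (+-identityʳ _) (+-identityʳ _)
  last (suc s) H = trans (+-identityˡ _) (last s (λ a → H (suc a)))

-- A composition of p + 1 + a into a + 1 parts is read off from the word of its
-- partial sums, which has p letters false and a letters true.
∑-comps-wordsWith : (G : Index → ℚ) (p a : ℕ) →
  ∑ G (comps (suc a) (suc p ℕ.+ a)) ≡ ∑ (λ w → G (fromBits w)) (wordsWith p a)
∑-comps-wordsWith G p zero = begin
  ∑ G (comps 1 (suc p ℕ.+ 0))
    ≡⟨ cong (λ s → ∑ G (comps 1 s)) (ℕₚ.+-identityʳ (suc p)) ⟩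
  ∑ G (comps 1 (suc p))
    ≡⟨ ∑-comps-one G p ⟩
  G [ suc p ]
    ≡⟨ cong G (sym (trans (fromBitsFrom-falses 1 p) (cong [_] (ℕₚ.+-comm p 1)))) ⟩
  G (fromBits (falses p))
    ≡⟨ sym (∑-wordsWith-zero (λ w → G (fromBits w)) p) ⟩
  ∑ (λ w → G (fromBits w)) (wordsWith p 0) ∎
  where open ≡-Reasoning
∑-comps-wordsWith G p (suc a) = begin
  ∑ G (comps (suc (suc a)) (suc p ℕ.+ suc a))
    ≡⟨ ∑-comps-suc G (suc a) (suc p ℕ.+ suc a) ⟩
  ∑< (suc p ℕ.+ suc a) K
    ≡⟨ ∑<-vanishing-tail (suc p) (suc a) K (λ i _ →
         ∑-comps-< _ (suc a) _ (n+m∸[1+n+i]<m p (suc a) i (s≤s z≤n))) ⟩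
  ∑< (suc p) K
    ≡⟨ ∑<-cong< (suc p) (λ b b≤p →
         trans (cong (λ s → ∑ (λ c → G (suc b ∷ c)) (comps (suc a) s))
                     (remaining b (ℕₚ.≤-pred b≤p)))
               (∑-comps-wordsWith (λ c → G (suc b ∷ c)) (p ∸ b) a)) ⟩
  ∑< (suc p) (λ b → ∑ (λ w → G (suc b ∷ fromBits w)) (wordsWith (p ∸ b) a))
    ≡⟨ ∑<-cong (suc p) (λ b → ∑-cong (wordsWith (p ∸ b) a) (λ w →
         cong G (sym (fromBits-falses-true b w)))) ⟩
  ∑< (suc p) (λ b → ∑ (λ w → G (fromBits (falses b ++ true ∷ w))) (wordsWith (p ∸ b) a))
    ≡⟨ sym (∑-wordsWith-first-true (λ w → G (fromBits w)) p a) ⟩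
  ∑ (λ w → G (fromBits w)) (wordsWith p (suc a)) ∎
  where
  open ≡-Reasoning
  K : ℕ → ℚ
  K b = ∑ (λ c → G (suc b ∷ c)) (comps (suc a) (p ℕ.+ suc a ∸ b))
  remaining : (b : ℕ) → b ≤ p → p ℕ.+ suc a ∸ b ≡ suc (p ∸ b) ℕ.+ a
  remaining b b≤p = trans (ℕₚ.+-∸-comm (suc a) b≤p) (ℕₚ.+-suc (p ∸ b) a)

∑-comps-insTrues-falses : (G : Index → ℚ) (p a : ℕ) →
  ∑ G (comps (suc a) (suc p ℕ.+ a)) ≡ ∑ (λ e → G (fromBits (insTrues (falses p) e))) (wcomps (suc p) a)
∑-comps-insTrues-falses G p a =
  trans (∑-comps-wordsWith G p a) (sym (∑-insTrues-falses (λ w → G (fromBits w)) p a))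

∑-insTrues-++-true : (G : List Bool → ℚ) (v w : List Bool) (t : ℕ) →
  sumInsTrues G (v ++ true ∷ w) t ≡
  ∑< (suc t) (λ a → ∑ (λ e₁ → ∑ (λ e₂ → G (insTrues v e₁ ++ true ∷ insTrues w e₂))
                                  (wcomps (suc (length w)) (t ∸ a)))
                        (wcomps (suc (length v)) a))
∑-insTrues-++-true G v w t = begin
  ∑ F (wcomps (suc (length (v ++ true ∷ w))) t)
    ≡⟨ cong (λ n → ∑ F (wcomps (suc n) t)) (length-++ v) ⟩
  ∑ F (wcomps (suc (length v) ℕ.+ suc (length w)) t)
    ≡⟨ ∑-wcomps-+ F (suc (length v)) (suc (length w)) t ⟩
  ∑< (suc t) (λ a → ∑ (λ e₁ → ∑ (λ e₂ → F (e₁ ++ e₂)) (wcomps (suc (length w)) (t ∸ a)))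
                        (wcomps (suc (length v)) a))
    ≡⟨ ∑<-cong (suc t) (λ a → ∑-wcomps-cong (suc (length v)) a (λ e₁ ∣e₁∣ →
         ∑-cong (wcomps (suc (length w)) (t ∸ a)) (λ e₂ →
           cong G (insTrues-++ v true w e₁ e₂ ∣e₁∣)))) ⟩
  ∑< (suc t) (λ a → ∑ (λ e₁ → ∑ (λ e₂ → G (insTrues v e₁ ++ true ∷ insTrues w e₂))
                                  (wcomps (suc (length w)) (t ∸ a)))
                        (wcomps (suc (length v)) a)) ∎
  where
  open ≡-Reasoning
  F : Index → ℚ
  F e = G (insTrues (v ++ true ∷ w) e)

∑-insTrues-falses-true : (G : Index → ℚ) (p : ℕ) (w : List Bool) (t : ℕ) →
  sumInsTrues (λ v → G (fromBits v)) (falses p ++ true ∷ w) t ≡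
  ∑< (suc t) (λ a → ∑ (λ c → sumInsTrues (λ v → G (c ++ fromBits v)) w (t ∸ a))
                        (comps (suc a) (p ℕ.+ suc a)))
∑-insTrues-falses-true G p w t = begin
  sumInsTrues (λ v → G (fromBits v)) (falses p ++ true ∷ w) t
    ≡⟨ ∑-insTrues-++-true (λ v → G (fromBits v)) (falses p) w t ⟩
  ∑< (suc t) (λ a → ∑ (λ e₁ → ∑ (λ e₂ → G (fromBits (insTrues (falses p) e₁ ++ true ∷ insTrues w e₂)))
                                 (wcomps (suc (length w)) (t ∸ a)))
                        (wcomps (suc (length (falses p))) a))
    ≡⟨ ∑<-cong (suc t) (λ a → ∑-cong (wcomps (suc (length (falses p))) a) (λ e₁ →
         ∑-cong (wcomps (suc (length w)) (t ∸ a)) (λ e₂ →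
           cong G (fromBitsFrom-++-true 1 (insTrues (falses p) e₁) (insTrues w e₂))))) ⟩
  ∑< (suc t) (λ a → ∑ (λ e₁ → Tail a (fromBits (insTrues (falses p) e₁)))
                        (wcomps (suc (length (falses p))) a))
    ≡⟨ cong (λ n → ∑< (suc t) (λ a → ∑ (λ e₁ → Tail a (fromBits (insTrues (falses p) e₁)))
                                        (wcomps (suc n) a)))
            (length-replicate p) ⟩
  ∑< (suc t) (λ a → ∑ (λ e₁ → Tail a (fromBits (insTrues (falses p) e₁))) (wcomps (suc p) a))
    ≡⟨ ∑<-cong (suc t) (λ a → sym (trans (cong (λ s → ∑ (Tail a) (comps (suc a) s))
                                               (ℕₚ.+-suc p a))
                                         (∑-comps-insTrues-falses (Tail a) p a))) ⟩
  ∑< (suc t) (λ a → ∑ (Tail a) (comps (suc a) (p ℕ.+ suc a))) ∎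
  where
  open ≡-Reasoning
  Tail : ℕ → Index → ℚ
  Tail a c = sumInsTrues (λ v → G (c ++ fromBits v)) w (t ∸ a)

∑-blocks-∷ : (G : Index → ℚ) (k m : ℕ) (rest : List (ℕ × ℕ)) →
  ∑ G (blocks ((k , m) ∷ rest)) ≡
  ∑ (λ c → ∑ (λ b → G (c ++ b)) (blocks rest)) (comps m (k ℕ.+ m ∸ 1))
∑-blocks-∷ G k m rest =
  trans (∑-concatMap G (λ c → map (c ++_) (blocks rest)) (comps m (k ℕ.+ m ∸ 1)))
        (∑-cong (comps m (k ℕ.+ m ∸ 1)) (λ c → ∑-map G (c ++_) (blocks rest)))

-- Each block of a summand of f_L is a composition of k_i + m_i − 1 into m_i parts, i.e. the
-- word of k_i with m_i − 1 letters true inserted; the blocks are joined by a letter true.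
∑-blocks-insTrues : (p : ℕ) (ks : Index) → All (1 ≤_) ks → (t : ℕ) (G : Index → ℚ) →
  ∑ (λ ms → ∑ G (blocks (zip (suc p ∷ ks) (map suc ms)))) (wcomps (suc (length ks)) t) ≡
  sumInsTrues (λ v → G (fromBits v)) (toBits (suc p ∷ ks)) t
∑-blocks-insTrues p [] [] t G = begin
  ∑ (λ ms → ∑ G (blocks (zip (suc p ∷ []) (map suc ms)))) (wcomps 1 t)
    ≡⟨ ∑-wcomps-one (λ ms → ∑ G (blocks (zip (suc p ∷ []) (map suc ms)))) t ⟩
  ∑ G (blocks [ (suc p , suc t) ])
    ≡⟨ ∑-blocks-∷ G (suc p) (suc t) [] ⟩
  ∑ (λ c → G (c ++ []) + 0ℚ) (comps (suc t) (p ℕ.+ suc t))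
    ≡⟨ ∑-cong (comps (suc t) (p ℕ.+ suc t)) (λ c → trans (+-identityʳ _) (cong G (++-identityʳ c))) ⟩
  ∑ G (comps (suc t) (p ℕ.+ suc t))
    ≡⟨ cong (λ s → ∑ G (comps (suc t) s)) (ℕₚ.+-suc p t) ⟩
  ∑ G (comps (suc t) (suc p ℕ.+ t))
    ≡⟨ ∑-comps-insTrues-falses G p t ⟩
  ∑ (λ e → G (fromBits (insTrues (falses p) e))) (wcomps (suc p) t)
    ≡⟨ cong (λ m → ∑ (λ e → G (fromBits (insTrues (falses p) e))) (wcomps (suc m) t))
            (sym (length-replicate p)) ⟩
  sumInsTrues (λ v → G (fromBits v)) (toBits (suc p ∷ [])) t ∎
  where open ≡-Reasoning
∑-blocks-insTrues p (suc p′ ∷ ks) (s≤s z≤n ∷ ks≥1) t G = begin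
  ∑ (λ ms → ∑ G (blocks (zip (suc p ∷ suc p′ ∷ ks) (map suc ms)))) (wcomps (suc (suc (length ks))) t)
    ≡⟨ ∑-wcomps-suc _ (suc (length ks)) t ⟩
  ∑< (suc t) (λ a → ∑ (λ ms → ∑ G (blocks ((suc p , suc a) ∷ rest ms))) (Ms a))
    ≡⟨ ∑<-cong (suc t) (λ a → ∑-cong (Ms a) (λ ms → ∑-blocks-∷ G (suc p) (suc a) (rest ms))) ⟩
  ∑< (suc t) (λ a → ∑ (λ ms → ∑ (λ c → ∑ (λ b → G (c ++ b)) (blocks (rest ms))) (Cs a)) (Ms a))
    ≡⟨ ∑<-cong (suc t) (λ a →
         ∑-comm (λ ms c → ∑ (λ b → G (c ++ b)) (blocks (rest ms))) (Ms a) (Cs a)) ⟩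
  ∑< (suc t) (λ a → ∑ (λ c → ∑ (λ ms → ∑ (λ b → G (c ++ b)) (blocks (rest ms))) (Ms a)) (Cs a))
    ≡⟨ ∑<-cong (suc t) (λ a → ∑-cong (Cs a) (λ c →
         ∑-blocks-insTrues p′ ks ks≥1 (t ∸ a) (λ b → G (c ++ b)))) ⟩
  ∑< (suc t) (λ a → ∑ (λ c → sumInsTrues (λ v → G (c ++ fromBits v)) (toBits (suc p′ ∷ ks)) (t ∸ a))
                        (Cs a))
    ≡⟨ sym (∑-insTrues-falses-true G p (toBits (suc p′ ∷ ks)) t) ⟩
  sumInsTrues (λ v → G (fromBits v)) (toBits (suc p ∷ suc p′ ∷ ks)) t ∎
  where
  open ≡-Reasoning
  rest : Index → List (ℕ × ℕ)
  rest ms = zip (suc p′ ∷ ks) (map suc ms)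
  Ms : ℕ → List Index
  Ms a = wcomps (suc (length ks)) (t ∸ a)
  Cs : ℕ → List Index
  Cs a = comps (suc a) (p ℕ.+ suc a)

fLN-insTrues : (N p : ℕ) (ks : Index) → All (1 ≤_) ks → (t : ℕ) →
  fLN N (suc p ∷ ks) t ≡ sumInsTrues (λ v → zetaPlusN N (fromBits v)) (toBits (suc p ∷ ks)) t
fLN-insTrues N p ks ks≥1 t =
  trans (∑-comps-wcomps (λ ms → ∑ (zetaPlusN N) (blocks (zip (suc p ∷ ks) ms))) (suc (length ks)) t)
        (∑-blocks-insTrues p ks ks≥1 t (zetaPlusN N))

sh-[]ʳ : (xs : Index) → sh xs [] ≡ [ xs ]
sh-[]ʳ []       = refl
sh-[]ʳ (x ∷ xs) = refl

∑-sh-∷-ones : (F : Index → ℚ) (y : ℕ) (mid : Index) (u : ℕ) →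
  ∑ F (sh (y ∷ mid) (replicate u 1)) ≡
  ∑< (suc u) (λ a → ∑ (λ w → F (replicate a 1 ++ y ∷ w)) (sh mid (replicate (u ∸ a) 1)))
∑-sh-∷-ones F y mid zero =
  trans (+-identityʳ (F (y ∷ mid)))
        (sym (trans (+-identityʳ _)
                    (trans (cong (∑ (λ w → F (y ∷ w))) (sh-[]ʳ mid)) (+-identityʳ _))))
∑-sh-∷-ones F y mid (suc u) =
  trans (∑-++-prefixed F y 1 (sh mid (replicate (suc u) 1)) (sh (y ∷ mid) (replicate u 1)))
        (cong (∑ (λ w → F (y ∷ w)) (sh mid (replicate (suc u) 1)) +_)
              (∑-sh-∷-ones (λ w → F (1 ∷ w)) y mid u))

∑-kU : (H : Index → ℚ) (x kr : ℕ) (mid : Index) (u : ℕ) →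
  ∑ H (kU x mid kr u) ≡ ∑ (λ ms → H (insOnes (x ∷ mid ++ [ kr ]) ms)) (wcomps (length (mid ++ [ kr ])) u)
∑-kU H x kr []        u =
  trans (+-identityʳ _) (sym (∑-wcomps-one (λ ms → H (insOnes (x ∷ [ kr ]) ms)) u))
∑-kU H x kr (y ∷ mid) u = begin
  ∑ H (map (λ w → x ∷ (w ++ [ kr ])) (sh (y ∷ mid) (replicate u 1)))
    ≡⟨ ∑-map H (λ w → x ∷ (w ++ [ kr ])) (sh (y ∷ mid) (replicate u 1)) ⟩
  ∑ (λ w → H (x ∷ (w ++ [ kr ]))) (sh (y ∷ mid) (replicate u 1))
    ≡⟨ ∑-sh-∷-ones (λ w → H (x ∷ (w ++ [ kr ]))) y mid u ⟩
  ∑< (suc u) (λ a → ∑ (λ w → H (x ∷ ((replicate a 1 ++ y ∷ w) ++ [ kr ])))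
                        (sh mid (replicate (u ∸ a) 1)))
    ≡⟨ ∑<-cong (suc u) (λ a → ∑-cong (sh mid (replicate (u ∸ a) 1)) (λ w →
         cong (λ v → H (x ∷ v)) (++-assoc (replicate a 1) (y ∷ w) [ kr ]))) ⟩
  ∑< (suc u) (λ a → ∑ (λ w → H (x ∷ replicate a 1 ++ y ∷ (w ++ [ kr ])))
                        (sh mid (replicate (u ∸ a) 1)))
    ≡⟨ ∑<-cong (suc u) (λ a →
         trans (sym (∑-map (λ v → H (x ∷ replicate a 1 ++ v)) (λ w → y ∷ (w ++ [ kr ]))
                           (sh mid (replicate (u ∸ a) 1))))
               (∑-kU (λ v → H (x ∷ replicate a 1 ++ v)) y kr mid (u ∸ a))) ⟩
  ∑< (suc u) (λ a → ∑ (λ ms → H (x ∷ replicate a 1 ++ insOnes (y ∷ mid ++ [ kr ]) ms))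
                        (wcomps (length (mid ++ [ kr ])) (u ∸ a)))
    ≡⟨ sym (∑-wcomps-suc (λ ms → H (insOnes (x ∷ y ∷ mid ++ [ kr ]) ms)) (length (mid ++ [ kr ])) u) ⟩
  ∑ (λ ms → H (insOnes (x ∷ y ∷ mid ++ [ kr ]) ms)) (wcomps (length (y ∷ mid ++ [ kr ])) u) ∎
  where open ≡-Reasoning

commaBits-ones-++ : (m : ℕ) (ks : Index) → commaBits (replicate m 1 ++ ks) ≡ trues m ++ commaBits ks
commaBits-ones-++ zero    ks = refl
commaBits-ones-++ (suc m) ks =
  cong (true ∷_) (trans (toBits-∷ 1 (replicate m 1 ++ ks)) (commaBits-ones-++ m ks))

commaBits-insOnes : (k : ℕ) (ks ms : Index) →
                    commaBits (insOnes (k ∷ ks) ms) ≡ true ∷ toBits (insOnes (k ∷ ks) ms)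
commaBits-insOnes k ks []       = refl
commaBits-insOnes k ks (m ∷ ms) = refl

toBits-insOnes : (k : ℕ) (ks ms : Index) → length ms ≡ length ks →
                 toBits (insOnes (k ∷ ks) ms) ≡ insTruesAfterTrues (toBits (k ∷ ks)) ms
toBits-insOnes k [] [] _ = sym (begin
  insTruesAfterTrues (falses (k ∸ 1)) []
    ≡⟨ cong (λ w → insTruesAfterTrues w []) (sym (++-identityʳ _)) ⟩
  insTruesAfterTrues (falses (k ∸ 1) ++ []) []
    ≡⟨ insTruesAfterTrues-falses-++ (k ∸ 1) [] [] ⟩
  falses (k ∸ 1) ++ []
    ≡⟨ ++-identityʳ _ ⟩
  falses (k ∸ 1) ∎)
  where open ≡-Reasoning
toBits-insOnes k (k′ ∷ ks) (m ∷ ms) ∣ms∣ = begin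
  toBits (k ∷ replicate m 1 ++ insOnes (k′ ∷ ks) ms)
    ≡⟨ toBits-∷ k (replicate m 1 ++ insOnes (k′ ∷ ks) ms) ⟩
  falses (k ∸ 1) ++ commaBits (replicate m 1 ++ insOnes (k′ ∷ ks) ms)
    ≡⟨ cong (falses (k ∸ 1) ++_) (commaBits-ones-++ m (insOnes (k′ ∷ ks) ms)) ⟩
  falses (k ∸ 1) ++ trues m ++ commaBits (insOnes (k′ ∷ ks) ms)
    ≡⟨ cong (λ w → falses (k ∸ 1) ++ trues m ++ w) (commaBits-insOnes k′ ks ms) ⟩
  falses (k ∸ 1) ++ trues m ++ true ∷ toBits (insOnes (k′ ∷ ks) ms)
    ≡⟨ cong (λ w → falses (k ∸ 1) ++ trues m ++ true ∷ w)
            (toBits-insOnes k′ ks ms (ℕₚ.suc-injective ∣ms∣)) ⟩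
  falses (k ∸ 1) ++ trues m ++ true ∷ insTruesAfterTrues (toBits (k′ ∷ ks)) ms
    ≡⟨ cong (falses (k ∸ 1) ++_) (sym (replicate-suc-++ m true _)) ⟩
  falses (k ∸ 1) ++ insTruesAfterTrues (true ∷ toBits (k′ ∷ ks)) (m ∷ ms)
    ≡⟨ sym (insTruesAfterTrues-falses-++ (k ∸ 1) (true ∷ toBits (k′ ∷ ks)) (m ∷ ms)) ⟩
  insTruesAfterTrues (toBits (k ∷ k′ ∷ ks)) (m ∷ ms) ∎
  where open ≡-Reasoning

#true-toBits : (k : ℕ) (ks : Index) → #true (toBits (k ∷ ks)) ≡ length ks
#true-toBits k []        = trans (cong #true (toBits-∷ k [])) (#true-falses-++ (k ∸ 1) [])
#true-toBits k (k′ ∷ ks) =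
  trans (#true-falses-++ (k ∸ 1) (true ∷ toBits (k′ ∷ ks))) (cong suc (#true-toBits k′ ks))

fLN-as-gRN : (N p kr : ℕ) (mid : Index) → All (1 ≤_) (mid ++ [ kr ]) → (t : ℕ) →
  fLN N (suc p ∷ mid ++ [ kr ]) t ≡ ∑< (suc t) (λ u → ∑ (λ y → gRN N y (t ∸ u)) (kU (suc p) mid kr u))
fLN-as-gRN N p kr mid ks≥1 t = begin
  fLN N k t
    ≡⟨ fLN-insTrues N p rest ks≥1 t ⟩
  sumInsTrues z w t
    ≡⟨ ∑-insTrues-split w t z ⟩
  ∑< (suc t) (λ u → ∑ (λ m → P m (t ∸ u)) (wcomps (#true w) u))
    ≡⟨ ∑<-cong (suc t) (λ u →
         cong (λ n → ∑ (λ m → P m (t ∸ u)) (wcomps n u)) (#true-toBits (suc p) rest)) ⟩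
  ∑< (suc t) (λ u → ∑ (λ m → P m (t ∸ u)) (wcomps (length rest) u))
    ≡⟨ ∑<-cong (suc t) (λ u →
         ∑-wcomps-cong (length rest) u (λ m ∣m∣ → sym (gRN-insOnes m ∣m∣ (t ∸ u)))) ⟩
  ∑< (suc t) (λ u → ∑ (λ m → gRN N (insOnes k m) (t ∸ u)) (wcomps (length rest) u))
    ≡⟨ ∑<-cong (suc t) (λ u → sym (∑-kU (λ y → gRN N y (t ∸ u)) (suc p) kr mid u)) ⟩
  ∑< (suc t) (λ u → ∑ (λ y → gRN N y (t ∸ u)) (kU (suc p) mid kr u)) ∎
  where
  open ≡-Reasoning
  rest k : Index
  rest = mid ++ [ kr ]
  k = suc p ∷ rest
  w : List Bool
  w = toBits k
  z : List Bool → ℚ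
  z v = zetaPlusN N (fromBits v)
  P : Index → ℕ → ℚ
  P m s = ∑ (λ e → z (insTruesBeforeFalses (insTruesAfterTrues w m) e)) (wcomps (suc (#false w)) s)
  gRN-insOnes : ∀ m → length m ≡ length rest → ∀ s → gRN N (insOnes k m) s ≡ P m s
  gRN-insOnes m ∣m∣ s = begin
    gRN N (insOnes k m) s
      ≡⟨ gRN-insTruesBeforeFalses N (insOnes k m) s ⟩
    sumInsTruesBeforeFalses z (toBits (insOnes k m)) s
      ≡⟨ cong (λ v → sumInsTruesBeforeFalses z v s) (toBits-insOnes (suc p) rest m ∣m∣) ⟩
    sumInsTruesBeforeFalses z (insTruesAfterTrues w m) s
      ≡⟨ cong (λ n → ∑ (λ e → z (insTruesBeforeFalses (insTruesAfterTrues w m) e)) (wcomps (suc n) s))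
              (#false-insTruesAfterTrues w m) ⟩
    P m s ∎

fRN-as-gLN : (N x kr : ℕ) (mid : Index) (t : ℕ) →
  fRN N (x ∷ mid ++ [ kr ]) t ≡ ∑< (suc t) (λ u → ∑ (λ y → gLN N y (t ∸ u)) (kU x mid kr u))
fRN-as-gLN N x kr mid t = begin
  fRN N (x ∷ mid ++ [ kr ]) t
    ≡⟨ ∑-upTo (λ l → F l (t ∸ l)) (suc t) ⟩
  ∑< (suc t) (λ l → F l (t ∸ l))
    ≡⟨ ∑<-reverse t F ⟩
  ∑< (suc t) (λ u → F (t ∸ u) u)
    ≡⟨ ∑<-cong (suc t) (λ u → sym (∑-kU (λ y → gLN N y (t ∸ u)) x kr mid u)) ⟩
  ∑< (suc t) (λ u → ∑ (λ y → gLN N y (t ∸ u)) (kU x mid kr u)) ∎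
  where
  open ≡-Reasoning
  F : ℕ → ℕ → ℚ
  F l u = ∑ (λ ms → gLN N (insOnes (x ∷ mid ++ [ kr ]) ms) l) (wcomps (length (mid ++ [ kr ])) u)

identity1N≡0 : (p kr : ℕ) (mid : Index) → All (1 ≤_) mid → 1 ≤ kr → (t N : ℕ) →
               identity1N (suc p) kr mid t N ≡ 0ℚ
identity1N≡0 p kr mid mid≥1 kr≥1 t N = begin
  (fL + - fR) + ∑ (λ u → gΣ N (ku u) (t ∸ u)) (upTo (suc t))
    ≡⟨ cong ((fL + - fR) +_) (∑-upTo (λ u → gΣ N (ku u) (t ∸ u)) (suc t)) ⟩
  (fL + - fR) + ∑< (suc t) (λ u → ∑ (λ y → gLN N y (t ∸ u) + - gRN N y (t ∸ u)) (ku u))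
    ≡⟨ cong ((fL + - fR) +_)
            (∑<-∑-difference (suc t) (λ u y → gLN N y (t ∸ u)) (λ u y → gRN N y (t ∸ u)) ku) ⟩
  (fL + - fR) + (∑<-ku gLN + - ∑<-ku gRN)
    ≡⟨ cong₂ (λ a b → (fL + - fR) + (a + - b))
             (sym (fRN-as-gLN N (suc p) kr mid t)) (sym (fLN-as-gRN N p kr mid (++⁺ mid≥1 (kr≥1 ∷ [])) t)) ⟩
  (fL + - fR) + (fR + - fL)
    ≡⟨ solve 2 (λ a b → (a :+ :- b) :+ (b :+ :- a) := con 0ℚ) refl fL fR ⟩
  0ℚ ∎
  where
  open ≡-Reasoning
  k : Index
  k = suc p ∷ mid ++ [ kr ]
  fL fR : ℚ
  fL = fLN N k t
  fR = fRN N k t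
  ku : ℕ → List Index
  ku = kU (suc p) mid kr
  ∑<-ku : (ℕ → Index → ℕ → ℚ) → ℚ
  ∑<-ku h = ∑< (suc t) (λ u → ∑ (λ y → h N y (t ∸ u)) (ku u))

∑-∑-sh-∷ : (f : Index → ℚ) (x y : ℕ) (l r : A → Index) (ws : List A) →
  ∑ (λ w → ∑ f (sh (x ∷ l w) (y ∷ r w))) ws ≡
  ∑ (λ w → ∑ (λ v → f (x ∷ v)) (sh (l w) (y ∷ r w))) ws +
  ∑ (λ w → ∑ (λ v → f (y ∷ v)) (sh (x ∷ l w) (r w))) ws
∑-∑-sh-∷ f x y l r ws =
  trans (∑-cong ws (λ w → ∑-++-prefixed f x y (sh (l w) (y ∷ r w)) (sh (x ∷ l w) (r w))))
        (∑-+ _ _ ws)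

∑-sh-assoc : (a b c : Index) (f : Index → ℚ) →
             ∑ (λ w → ∑ f (sh w c)) (sh a b) ≡ ∑ (λ w → ∑ f (sh a w)) (sh b c)
∑-sh-assoc []      b       c       f =
  trans (+-identityʳ _) (sym (∑-cong (sh b c) (λ w → +-identityʳ (f w))))
∑-sh-assoc (x ∷ a) []      c       f = refl
∑-sh-assoc (x ∷ a) (y ∷ b) []      f =
  trans (∑-cong (sh (x ∷ a) (y ∷ b)) (λ w → trans (cong (∑ f) (sh-[]ʳ w)) (+-identityʳ (f w))))
        (sym (+-identityʳ _))
∑-sh-assoc (x ∷ a) (y ∷ b) (z ∷ c) f = begin
  ∑ (λ w → ∑ f (sh w (z ∷ c))) (map (x ∷_) (sh a (y ∷ b)) ++ map (y ∷_) (sh (x ∷ a) b))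
    ≡⟨ ∑-++-prefixed (λ w → ∑ f (sh w (z ∷ c))) x y (sh a (y ∷ b)) (sh (x ∷ a) b) ⟩
  ∑ (λ w → ∑ f (sh (x ∷ w) (z ∷ c))) (sh a (y ∷ b)) +
  ∑ (λ w → ∑ f (sh (y ∷ w) (z ∷ c))) (sh (x ∷ a) b)
    ≡⟨ cong₂ _+_ (∑-∑-sh-∷ f x z (λ w → w) (λ _ → c) (sh a (y ∷ b)))
                 (∑-∑-sh-∷ f y z (λ w → w) (λ _ → c) (sh (x ∷ a) b)) ⟩
  (X + Zˣ) + (Y + Zʸ)
    ≡⟨ +-interchange X Zˣ Y Zʸ ⟩
  (X + Y) + (Zˣ + Zʸ)
    ≡⟨ cong₂ _+_ (cong₂ _+_ (∑-sh-assoc a (y ∷ b) (z ∷ c) fx) (∑-sh-assoc (x ∷ a) b (z ∷ c) fy))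
                 (trans (sym (∑-++-prefixed (λ w → ∑ fz (sh w c)) x y (sh a (y ∷ b)) (sh (x ∷ a) b)))
                        (∑-sh-assoc (x ∷ a) (y ∷ b) c fz)) ⟩
  (∑ (λ w → ∑ fx (sh a w)) (sh (y ∷ b) (z ∷ c)) + Q₃) + Q₄
    ≡⟨ cong (λ q → (q + Q₃) + Q₄)
            (∑-++-prefixed (λ w → ∑ fx (sh a w)) y z (sh b (z ∷ c)) (sh (y ∷ b) c)) ⟩
  ((Q₁ + Q₂) + Q₃) + Q₄
    ≡⟨ solve 4 (λ q₁ q₂ q₃ q₄ → ((q₁ :+ q₂) :+ q₃) :+ q₄ := (q₁ :+ q₃) :+ (q₂ :+ q₄))
               refl Q₁ Q₂ Q₃ Q₄ ⟩
  (Q₁ + Q₃) + (Q₂ + Q₄)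
    ≡⟨ sym (cong₂ _+_ (∑-∑-sh-∷ f x y (λ _ → a) (λ w → w) (sh b (z ∷ c)))
                      (∑-∑-sh-∷ f x z (λ _ → a) (λ w → w) (sh (y ∷ b) c))) ⟩
  ∑ (λ w → ∑ f (sh (x ∷ a) (y ∷ w))) (sh b (z ∷ c)) +
  ∑ (λ w → ∑ f (sh (x ∷ a) (z ∷ w))) (sh (y ∷ b) c)
    ≡⟨ sym (∑-++-prefixed (λ w → ∑ f (sh (x ∷ a) w)) y z (sh b (z ∷ c)) (sh (y ∷ b) c)) ⟩
  ∑ (λ w → ∑ f (sh (x ∷ a) w)) (map (y ∷_) (sh b (z ∷ c)) ++ map (z ∷_) (sh (y ∷ b) c)) ∎
  where
  open ≡-Reasoning
  fx fy fz : Index → ℚ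
  fx v = f (x ∷ v)
  fy v = f (y ∷ v)
  fz v = f (z ∷ v)
  X Y Zˣ Zʸ Q₁ Q₂ Q₃ Q₄ : ℚ
  X  = ∑ (λ w → ∑ fx (sh w (z ∷ c))) (sh a (y ∷ b))
  Y  = ∑ (λ w → ∑ fy (sh w (z ∷ c))) (sh (x ∷ a) b)
  Zˣ = ∑ (λ w → ∑ fz (sh (x ∷ w) c)) (sh a (y ∷ b))
  Zʸ = ∑ (λ w → ∑ fz (sh (y ∷ w) c)) (sh (x ∷ a) b)
  Q₁ = ∑ (λ w → ∑ fx (sh a (y ∷ w))) (sh b (z ∷ c))
  Q₂ = ∑ (λ w → ∑ fx (sh a (z ∷ w))) (sh (y ∷ b) c)
  Q₃ = ∑ (λ w → ∑ fy (sh (x ∷ a) w)) (sh b (z ∷ c))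
  Q₄ = ∑ (λ w → ∑ fz (sh (x ∷ a) w)) (sh (y ∷ b) c)

binomial : ℕ → ℕ → ℚ
binomial n       zero    = 1ℚ
binomial zero    (suc k) = 0ℚ
binomial (suc n) (suc k) = binomial n k + binomial n (suc k)

binomial-> : (n k : ℕ) → n < k → binomial n k ≡ 0ℚ
binomial-> zero    (suc k) _         = refl
binomial-> (suc n) (suc k) (s≤s n<k) =
  trans (cong₂ _+_ (binomial-> n k n<k) (binomial-> n (suc k) (ℕₚ.m<n⇒m<1+n n<k))) (+-identityʳ 0ℚ)

binomial-diagonal : (n : ℕ) → binomial n n ≡ 1ℚ
binomial-diagonal zero    = refl
binomial-diagonal (suc n) =
  trans (cong₂ _+_ (binomial-diagonal n) (binomial-> n (suc n) (ℕₚ.n<1+n n))) (+-identityʳ 1ℚ)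

∑-sh-ones : (g : Index → ℚ) (u v : ℕ) →
  ∑ g (sh (replicate u 1) (replicate v 1)) ≡ binomial (u ℕ.+ v) u * g (replicate (u ℕ.+ v) 1)
∑-sh-ones g zero    v    = trans (+-identityʳ (g (replicate v 1))) (sym (*-identityˡ _))
∑-sh-ones g (suc u) zero = begin
  g (replicate (suc u) 1) + 0ℚ
    ≡⟨ +-identityʳ _ ⟩
  g (replicate (suc u) 1)
    ≡⟨ sym (*-identityˡ _) ⟩
  1ℚ * g (replicate (suc u) 1)
    ≡⟨ cong (_* g (replicate (suc u) 1)) (sym (binomial-diagonal (suc u))) ⟩
  binomial (suc u) (suc u) * g (replicate (suc u) 1)
    ≡⟨ cong (λ n → binomial n (suc u) * g (replicate n 1)) (sym (ℕₚ.+-identityʳ (suc u))) ⟩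
  binomial (suc u ℕ.+ 0) (suc u) * g (replicate (suc u ℕ.+ 0) 1) ∎
  where open ≡-Reasoning
∑-sh-ones g (suc u) (suc v) = begin
  ∑ g (map (1 ∷_) (sh (ones u) (ones (suc v))) ++ map (1 ∷_) (sh (ones (suc u)) (ones v)))
    ≡⟨ ∑-++-prefixed g 1 1 (sh (ones u) (ones (suc v))) (sh (ones (suc u)) (ones v)) ⟩
  ∑ g₁ (sh (ones u) (ones (suc v))) + ∑ g₁ (sh (ones (suc u)) (ones v))
    ≡⟨ cong₂ _+_ (∑-sh-ones g₁ u (suc v)) (∑-sh-ones g₁ (suc u) v) ⟩
  binomial n u * g₁ (ones n) + binomial (suc u ℕ.+ v) (suc u) * g₁ (ones (suc u ℕ.+ v))
    ≡⟨ cong (λ m → binomial n u * g₁ (ones n) + binomial m (suc u) * g₁ (ones m))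
            (sym (ℕₚ.+-suc u v)) ⟩
  binomial n u * g₁ (ones n) + binomial n (suc u) * g₁ (ones n)
    ≡⟨ sym (*-distribʳ-+ (g₁ (ones n)) (binomial n u) (binomial n (suc u))) ⟩
  binomial (suc n) (suc u) * g (ones (suc n)) ∎
  where
  open ≡-Reasoning
  ones : ℕ → Index
  ones m = replicate m 1
  n : ℕ
  n = u ℕ.+ suc v
  g₁ : Index → ℚ
  g₁ w = g (1 ∷ w)

sign : ℕ → ℚ
sign = pow (- 1ℚ)

altBinomial : ℕ → ℕ → ℚ
altBinomial m n = ∑< m (λ k → sign k * binomial n k)

altBinomial-pascal : (m n : ℕ) → altBinomial (suc m) (suc n) ≡ altBinomial (suc m) n + - altBinomial m n
altBinomial-pascal m n = begin
  1ℚ * 1ℚ + ∑< m (λ k → sign (suc k) * (binomial n k + binomial n (suc k)))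
    ≡⟨ cong (1ℚ * 1ℚ +_) (∑<-cong m (λ k → pascal-term (sign k) (binomial n k) (binomial n (suc k)))) ⟩
  1ℚ * 1ℚ + ∑< m (λ k → shifted k + - (sign k * binomial n k))
    ≡⟨ cong (1ℚ * 1ℚ +_) (trans (∑<-+ m shifted (λ k → - (sign k * binomial n k)))
                                (cong (∑< m shifted +_) (∑<-neg m (λ k → sign k * binomial n k)))) ⟩
  1ℚ * 1ℚ + (∑< m shifted + - altBinomial m n)
    ≡⟨ sym (+-assoc (1ℚ * 1ℚ) (∑< m shifted) _) ⟩
  altBinomial (suc m) n + - altBinomial m n ∎
  where
  open ≡-Reasoning
  shifted : ℕ → ℚ
  shifted k = sign (suc k) * binomial n (suc k)
  pascal-term : ∀ s a b → (- 1ℚ * s) * (a + b) ≡ (- 1ℚ * s) * b + - (s * a)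
  pascal-term = solve 3 (λ s a b → (:- con 1ℚ :* s) :* (a :+ b) := (:- con 1ℚ :* s) :* b :+ :- (s :* a)) refl

altBinomial-row : (n : ℕ) → altBinomial (suc (suc n)) (suc n) ≡ 0ℚ
altBinomial-row n = begin
  altBinomial (suc (suc n)) (suc n)
    ≡⟨ altBinomial-pascal (suc n) n ⟩
  altBinomial (suc (suc n)) n + - altBinomial (suc n) n
    ≡⟨ cong (_+ - T) (∑<-snoc (suc n) (λ k → sign k * binomial n k)) ⟩
  (T + sign (suc n) * binomial n (suc n)) + - T
    ≡⟨ cong (λ b → (T + sign (suc n) * b) + - T) (binomial-> n (suc n) (ℕₚ.n<1+n n)) ⟩
  (T + sign (suc n) * 0ℚ) + - T
    ≡⟨ solve 2 (λ a s → (a :+ s :* con 0ℚ) :+ :- a := con 0ℚ) refl T (sign (suc n)) ⟩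
  0ℚ ∎
  where
  open ≡-Reasoning
  T : ℚ
  T = altBinomial (suc n) n

∑-altBinomial-weighted : (t : ℕ) (Ψ : ℕ → ℚ) →
                         ∑< (suc t) (λ n → altBinomial (suc n) n * Ψ n) ≡ Ψ 0
∑-altBinomial-weighted t Ψ = begin
  (1ℚ * 1ℚ + 0ℚ) * Ψ 0 + ∑< t (λ n → altBinomial (suc (suc n)) (suc n) * Ψ (suc n))
    ≡⟨ cong ((1ℚ * 1ℚ + 0ℚ) * Ψ 0 +_) (trans (∑<-cong t row-vanishes) (∑<-zero t)) ⟩
  (1ℚ * 1ℚ + 0ℚ) * Ψ 0 + 0ℚ
    ≡⟨ solve 1 (λ x → (con 1ℚ :* con 1ℚ :+ con 0ℚ) :* x :+ con 0ℚ := x) refl (Ψ 0) ⟩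
  Ψ 0 ∎
  where
  open ≡-Reasoning
  row-vanishes : ∀ n → altBinomial (suc (suc n)) (suc n) * Ψ (suc n) ≡ 0ℚ
  row-vanishes n = trans (cong (_* Ψ (suc n)) (altBinomial-row n)) (*-zeroˡ (Ψ (suc n)))

All-sh : {P : ℕ → Set} (xs ys : Index) → All P xs → All P ys → All (All P) (sh xs ys)
All-sh []       ys       _          pys        = pys ∷ []
All-sh (x ∷ xs) []       pxs        _          = pxs ∷ []
All-sh (x ∷ xs) (y ∷ ys) (px ∷ pxs) (py ∷ pys) =
  ++⁺ (map⁺ (All.map (px ∷_) (All-sh xs (y ∷ ys) pxs (py ∷ pys))))
      (map⁺ (All.map (py ∷_) (All-sh (x ∷ xs) ys (px ∷ pxs) pys)))

fN-as-gΣ : (p kr : ℕ) (mid : Index) → All (1 ≤_) mid → 1 ≤ kr → (s N : ℕ) →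
  fN N (suc p ∷ mid ++ [ kr ]) s ≡ - ∑< (suc s) (λ v → gΣ N (kU (suc p) mid kr v) (s ∸ v))
fN-as-gΣ p kr mid mid≥1 kr≥1 s N = begin
  fN N k s
    ≡⟨ solve 2 (λ a b → a := (a :+ b) :+ :- b) refl (fN N k s) G ⟩
  (fN N k s + G) + - G
    ≡⟨ cong (λ x → (fN N k s + x) + - G)
            (sym (∑-upTo (λ v → gΣ N (kU (suc p) mid kr v) (s ∸ v)) (suc s))) ⟩
  identity1N (suc p) kr mid s N + - G
    ≡⟨ cong (_+ - G) (identity1N≡0 p kr mid mid≥1 kr≥1 s N) ⟩
  0ℚ + - G
    ≡⟨ +-identityˡ (- G) ⟩
  - G ∎
  where
  open ≡-Reasoning
  k : Index
  k = suc p ∷ mid ++ [ kr ]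
  G : ℚ
  G = ∑< (suc s) (λ v → gΣ N (kU (suc p) mid kr v) (s ∸ v))

fΣ-kU-as-gΣ : (N p kr : ℕ) (mid : Index) → All (1 ≤_) mid → 1 ≤ kr → (u s : ℕ) →
  fΣ N (kU (suc p) mid kr u) s ≡
  - ∑< (suc s) (λ v → binomial (u ℕ.+ v) u * gΣ N (kU (suc p) mid kr (u ℕ.+ v)) (s ∸ v))
fΣ-kU-as-gΣ N p kr mid mid≥1 kr≥1 u s = begin
  ∑ (λ y → fN N y s) (map around (sh mid (ones u)))
    ≡⟨ ∑-map (λ y → fN N y s) around (sh mid (ones u)) ⟩
  ∑ (λ w → fN N (around w) s) (sh mid (ones u))
    ≡⟨ ∑-congᴬ (All.map (λ {w} w≥1 → fN-as-gΣ p kr w w≥1 kr≥1 s N)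
                        (All-sh mid (ones u) mid≥1 (replicate⁺ u (s≤s z≤n)))) ⟩
  ∑ (λ w → - ∑< (suc s) (λ v → g v (kU (suc p) w kr v))) (sh mid (ones u))
    ≡⟨ ∑-neg (λ w → ∑< (suc s) (λ v → g v (kU (suc p) w kr v))) (sh mid (ones u)) ⟩
  - ∑ (λ w → ∑< (suc s) (λ v → g v (kU (suc p) w kr v))) (sh mid (ones u))
    ≡⟨ cong -_ (sym (∑<-∑ (suc s) (λ v w → g v (kU (suc p) w kr v)) (sh mid (ones u)))) ⟩
  - ∑< (suc s) (λ v → ∑ (λ w → g v (kU (suc p) w kr v)) (sh mid (ones u)))
    ≡⟨ cong -_ (∑<-cong (suc s) shuffle-twice) ⟩
  - ∑< (suc s) (λ v → binomial (u ℕ.+ v) u * g v (kU (suc p) mid kr (u ℕ.+ v))) ∎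
  where
  open ≡-Reasoning
  ones : ℕ → Index
  ones n = replicate n 1
  around : Index → Index
  around w = suc p ∷ w ++ [ kr ]
  g : ℕ → List Index → ℚ
  g v ys = gΣ N ys (s ∸ v)
  shuffle-twice : ∀ v → ∑ (λ w → g v (kU (suc p) w kr v)) (sh mid (ones u)) ≡
                        binomial (u ℕ.+ v) u * g v (kU (suc p) mid kr (u ℕ.+ v))
  shuffle-twice v = begin
    ∑ (λ w → ∑ (λ y → gN N y (s ∸ v)) (map around (sh w (ones v)))) (sh mid (ones u))
      ≡⟨ ∑-cong (sh mid (ones u)) (λ w → ∑-map (λ y → gN N y (s ∸ v)) around (sh w (ones v))) ⟩
    ∑ (λ w → ∑ h (sh w (ones v))) (sh mid (ones u))
      ≡⟨ ∑-sh-assoc mid (ones u) (ones v) h ⟩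
    ∑ (λ c → ∑ h (sh mid c)) (sh (ones u) (ones v))
      ≡⟨ ∑-sh-ones (λ c → ∑ h (sh mid c)) u v ⟩
    binomial (u ℕ.+ v) u * ∑ h (sh mid (ones (u ℕ.+ v)))
      ≡⟨ cong (binomial (u ℕ.+ v) u *_)
              (sym (∑-map (λ y → gN N y (s ∸ v)) around (sh mid (ones (u ℕ.+ v))))) ⟩
    binomial (u ℕ.+ v) u * g v (kU (suc p) mid kr (u ℕ.+ v)) ∎
    where
    h : Index → ℚ
    h w = gN N (around w) (s ∸ v)

identity2N≡0 : (p kr : ℕ) (mid : Index) → All (1 ≤_) mid → 1 ≤ kr → (t N : ℕ) →
               identity2N (suc p) kr mid t N ≡ 0ℚ
identity2N≡0 p kr mid mid≥1 kr≥1 t N = begin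
  g + ∑ (λ u → sign u * fΣ N (ku u) (t ∸ u)) (upTo (suc t))
    ≡⟨ cong (g +_) (∑-upTo (λ u → sign u * fΣ N (ku u) (t ∸ u)) (suc t)) ⟩
  g + ∑< (suc t) (λ u → sign u * fΣ N (ku u) (t ∸ u))
    ≡⟨ cong (g +_) (∑<-cong (suc t) signed-term) ⟩
  g + ∑< (suc t) (λ u → - ∑< (suc (t ∸ u)) (λ v → K u v (t ∸ u ∸ v)))
    ≡⟨ cong (g +_) (trans (∑<-neg (suc t) (λ u → ∑< (suc (t ∸ u)) (λ v → K u v (t ∸ u ∸ v))))
                          (cong -_ (∑³-regroup t K))) ⟩
  g + - ∑< (suc t) (λ n → ∑< (suc n) (λ u → K u (n ∸ u) (t ∸ n)))
    ≡⟨ cong (λ x → g + - x) (∑<-cong (suc t) (λ n →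
         trans (∑<-cong< (suc n) (λ u u≤n → diagonal n u (ℕₚ.≤-pred u≤n)))
               (∑<-*ʳ (suc n) (λ u → sign u * binomial n u) (Ψ n (t ∸ n))))) ⟩
  g + - ∑< (suc t) (λ n → altBinomial (suc n) n * Ψ n (t ∸ n))
    ≡⟨ cong (λ x → g + - x) (∑-altBinomial-weighted t (λ n → Ψ n (t ∸ n))) ⟩
  g + - Ψ 0 t
    ≡⟨ cong (λ ws → g + - ∑ (λ y → gN N y t) (map (λ w → suc p ∷ w ++ [ kr ]) ws)) (sh-[]ʳ mid) ⟩
  g + - (g + 0ℚ)
    ≡⟨ solve 1 (λ x → x :+ :- (x :+ con 0ℚ) := con 0ℚ) refl g ⟩
  0ℚ ∎
  where
  open ≡-Reasoning
  g : ℚ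
  g = gN N (suc p ∷ mid ++ [ kr ]) t
  ku : ℕ → List Index
  ku = kU (suc p) mid kr
  Ψ : ℕ → ℕ → ℚ
  Ψ n s = gΣ N (ku n) s
  K : ℕ → ℕ → ℕ → ℚ
  K u v r = sign u * (binomial (u ℕ.+ v) u * Ψ (u ℕ.+ v) r)
  signed-term : ∀ u → sign u * fΣ N (ku u) (t ∸ u) ≡ - ∑< (suc (t ∸ u)) (λ v → K u v (t ∸ u ∸ v))
  signed-term u = begin
    sign u * fΣ N (ku u) (t ∸ u)
      ≡⟨ cong (sign u *_) (fΣ-kU-as-gΣ N p kr mid mid≥1 kr≥1 u (t ∸ u)) ⟩
    sign u * - ∑< (suc (t ∸ u)) T
      ≡⟨ solve 2 (λ a b → a :* :- b := :- (a :* b)) refl (sign u) (∑< (suc (t ∸ u)) T) ⟩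
    - (sign u * ∑< (suc (t ∸ u)) T)
      ≡⟨ cong -_ (sym (∑<-*ˡ (suc (t ∸ u)) (sign u) T)) ⟩
    - ∑< (suc (t ∸ u)) (λ v → K u v (t ∸ u ∸ v)) ∎
    where
    T : ℕ → ℚ
    T v = binomial (u ℕ.+ v) u * Ψ (u ℕ.+ v) (t ∸ u ∸ v)
  diagonal : (n u : ℕ) → u ≤ n → K u (n ∸ u) (t ∸ n) ≡ sign u * binomial n u * Ψ n (t ∸ n)
  diagonal n u u≤n = trans (cong (λ m → sign u * (binomial m u * Ψ m (t ∸ n))) (ℕₚ.m+[n∸m]≡n u≤n))
                           (sym (*-assoc (sign u) (binomial n u) (Ψ n (t ∸ n))))

≡0⇒TendsToZero : (s : ℕ → ℚ) → (∀ N → s N ≡ 0ℚ) → TendsToZero s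
≡0⇒TendsToZero s s≡0 ε ε>0 = 0 , λ N _ → subst (λ q → ∣ q ∣ ℚ.≤ ε) (sym (s≡0 N)) (<⇒≤ ε>0)

lemma3p5 : (k₁ kr : ℕ) (middle : List ℕ) (t : ℕ) →
    1 ≤ k₁ → All (1 ≤_) middle → 1 ≤ kr →
    TendsToZero (identity1N k₁ kr middle t) × TendsToZero (identity2N k₁ kr middle t)
lemma3p5 (suc p) kr middle t (s≤s z≤n) middle≥1 kr≥1 =
  ≡0⇒TendsToZero _ (identity1N≡0 p kr middle middle≥1 kr≥1 t) ,
  ≡0⇒TendsToZero _ (identity2N≡0 p kr middle middle≥1 kr≥1 t)
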